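{- The ruleset Beyond the door is a universal partizan ruleset.
   Context: Games are short two-player partizan combinatorial games (Left and Right) under normal play (the player making the last move wins). A ruleset is a universal partizan ruleset if every short partizan game value is equal to the value of some position of the ruleset. Beyond the door: a position consists of finitely many square rooms arranged in a grid pattern, with a door between each pair of adjacent rooms; each of the two sides of each door is painted red, blue, or black, and there are pieces in some rooms. On his/her turn a player chooses a piece and moves it in a straight line through one or more doors; whenever the piece moves through a door, the side of that door facing the room the piece is coming from must be painted in the mover's colour (blue for Left, red for Right). After a piece has passed a room, no piece may enter that room afterwards. The player who moves last wins. -}

module Defs where

open import Data.Nat using (ℕ; suc; _<_; _≤_)
open import Data.Integer as ℤ using (ℤ; +_; -[1+_])
open import Data.Product using (_×_; _,_; ∃)
open import Data.Sum using (_⊎_)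
open import Data.Empty using (⊥)
open import Data.List using (List; []; _∷_; _++_; map; upTo)
open import Data.List.Relation.Unary.Any using (Any)
open import Data.List.Relation.Unary.All using (All)
open import Data.List.Relation.Unary.Unique.Propositional using (Unique)
open import Data.List.Membership.Propositional using (_∈_)
open import Relation.Nullary using (¬_)
open import Relation.Binary.PropositionalEquality using (_≡_)

data Game : Set where
  ⟨_∣_⟩ : List Game → List Game → Game

mutual
  _≤G_ : Game → Game → Set
  ⟨ GL ∣ GR ⟩ ≤G ⟨ HL ∣ HR ⟩ =
    ¬ someLeftAbove GL ⟨ HL ∣ HR ⟩ × ¬ someRightBelow HR ⟨ GL ∣ GR ⟩

  someLeftAbove : List Game → Game → Set
  someLeftAbove []       H = ⊥
  someLeftAbove (g ∷ gs) H = (H ≤G g) ⊎ someLeftAbove gs H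

  someRightBelow : List Game → Game → Set
  someRightBelow []       G = ⊥
  someRightBelow (h ∷ hs) G = (h ≤G G) ⊎ someRightBelow hs G

_≈G_ : Game → Game → Set
G ≈G H = (G ≤G H) × (H ≤G G)

data Player : Set where
  Left Right : Player

data Colour : Set where
  blue red black : Colour

colourOf : Player → Colour
colourOf Left  = blue
colourOf Right = red

data Dir : Set where
  north south east west : Dir

-- rooms are unit squares of the grid, indexed by integer coordinates
Cell : Set
Cell = ℤ × ℤ

δx δy : Dir → ℤ
δx north = + 0
δx south = + 0
δx east  = + 1
δx west  = -[1+ 0 ]
δy north = + 1
δy south = -[1+ 0 ]
δy east  = + 0
δy west  = + 0

shift : Cell → Dir → ℕ → Cell
shift (x , y) d j = (x ℤ.+ (+ j) ℤ.* δx d , y ℤ.+ (+ j) ℤ.* δy d)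

-- A game state.  'side c d' is the colour of the side, facing room c, of the
-- door between room c and the room adjacent to c in direction d (only
-- meaningful when both rooms exist).  'passed' are the rooms that have
-- been passed by a piece and may not be entered any more.
record State : Set where
  constructor mkState
  field
    rooms  : List Cell
    side   : Cell → Dir → Colour
    pieces : List Cell
    passed : List Cell
open State public

data Move (p : Player) (s : State) : State → Set where
  move : (xs ys : List Cell) (c : Cell) (d : Dir) (k : ℕ) →
    pieces s ≡ xs ++ c ∷ ys →
    1 ≤ k →
    (∀ j → j < k →
        (shift c d j ∈ rooms s)
      × (shift c d (suc j) ∈ rooms s)
      × (side s (shift c d j) d ≡ colourOf p)
      × ¬ (shift c d (suc j) ∈ passed s)) →
    Move p s (mkState (rooms s) (side s)
                      (xs ++ shift c d k ∷ ys)
                      (passed s ++ map (shift c d) (upTo k)))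

-- 'IsValue s G': the game tree of state s is G, i.e. the Left options of G
-- are exactly (values of) the Left moves from s, and similarly for Right.
-- (Inductive, hence it also asserts the game from s is finite.)
data IsValue : State → Game → Set where
  val : ∀ {s} (Ls Rs : List Game) →
    (∀ s' → Move Left  s s' → Any (IsValue s') Ls) →
    All (λ g → ∃ λ s' → Move Left  s s' × IsValue s' g) Ls →
    (∀ s' → Move Right s s' → Any (IsValue s') Rs) →
    All (λ g → ∃ λ s' → Move Right s s' × IsValue s' g) Rs →
    IsValue s ⟨ Ls ∣ Rs ⟩

record Position : Set where
  constructor mkPosition
  field
    pRooms  : List Cell
    pSide   : Cell → Dir → Colour
    pPieces : List Cell
    piecesInRooms : All (_∈ pRooms) pPieces
    piecesDistinct : Unique pPieces

startState : Position → State
startState P = mkState (Position.pRooms P) (Position.pSide P) (Position.pPieces P) []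

HasValue : Position → Game → Set
HasValue P G = IsValue (startState P) G

UniversalBeyondTheDoor : Set
UniversalBeyondTheDoor =
  ∀ (G : Game) → ∃ λ (P : Position) → ∃ λ (H : Game) → HasValue P H × (H ≈G G)

module Submission where

-- A game G is first replaced by an equal game in which no option is dominated by a later option of
-- the same player. Its game tree is then drawn on the grid for a single piece: every node is a room
-- from which a blue ray of rooms leads to its Left options and a red ray to its Right options, and
-- the rays of a child run perpendicular to the ray carrying it. A piece may stop anywhere on a ray,
-- so moving to an option also offers the later rooms of that ray: later options are harmless by the
-- ordering, and the gap rooms that keep subtrees apart carry an arm of the opponent's colour worth an
-- integer beyond the birthday of G, so stopping there never helps (the gift horse principle). Rooms
-- left behind have values of larger birthday than every room still reachable, hence the rule against
-- re-entering them never removes a move; what remains is to check that the drawing does not overlap.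

open import Defs
open import Data.Nat using (ℕ)
open import Data.Product using (_×_; _,_; ∃; proj₁; proj₂)
open import Data.List using (List; []; _∷_; _++_; map; upTo)
open import Data.List.Membership.Propositional using (_∈_)
open import Relation.Binary.PropositionalEquality using (_≡_; refl; sym; trans; cong; cong₂; subst)

module Order where

  open import Data.Nat using (ℕ; zero; suc; _+_; _⊔_; _≤_; _<_; s≤s)
  open import Data.Nat.Properties
  open import Data.Product using (_×_; _,_; ∃; proj₁; proj₂)
  open import Data.Sum using (inj₁; inj₂)
  open import Data.List using (List; []; _∷_; _++_)
  open import Data.List.Relation.Unary.Any using (here; there)
  open import Data.List.Membership.Propositional using (_∈_)
  open import Data.List.Membership.Propositional.Properties using (∈-++⁺ʳ; ∈-++⁻)
  open import Relation.Nullary using (¬_)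
  open import Relation.Binary.PropositionalEquality using (_≡_; refl; sym; trans; subst)

  someLeftAbove→∈ : ∀ {gs H} → someLeftAbove gs H → ∃ λ g → g ∈ gs × (H ≤G g)
  someLeftAbove→∈ {g ∷ gs} (inj₁ p) = g , here refl , p
  someLeftAbove→∈ {g ∷ gs} (inj₂ p) = let h , h∈gs , q = someLeftAbove→∈ p in h , there h∈gs , q

  ∈→someLeftAbove : ∀ {gs H g} → g ∈ gs → H ≤G g → someLeftAbove gs H
  ∈→someLeftAbove (here refl) p = inj₁ p
  ∈→someLeftAbove (there g∈gs) p = inj₂ (∈→someLeftAbove g∈gs p)

  someRightBelow→∈ : ∀ {hs G} → someRightBelow hs G → ∃ λ h → h ∈ hs × (h ≤G G)
  someRightBelow→∈ {h ∷ hs} (inj₁ p) = h , here refl , p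
  someRightBelow→∈ {h ∷ hs} (inj₂ p) = let k , k∈hs , q = someRightBelow→∈ p in k , there k∈hs , q

  ∈→someRightBelow : ∀ {hs G h} → h ∈ hs → h ≤G G → someRightBelow hs G
  ∈→someRightBelow (here refl) p = inj₁ p
  ∈→someRightBelow (there h∈hs) p = inj₂ (∈→someRightBelow h∈hs p)

  ≤G-intro : ∀ {GL GR HL HR} →
    (∀ {g} → g ∈ GL → ¬ (⟨ HL ∣ HR ⟩ ≤G g)) →
    (∀ {h} → h ∈ HR → ¬ (h ≤G ⟨ GL ∣ GR ⟩)) →
    ⟨ GL ∣ GR ⟩ ≤G ⟨ HL ∣ HR ⟩
  ≤G-intro f g = (λ s → let _ , m , p = someLeftAbove→∈ s in f m p)
               , (λ s → let _ , m , p = someRightBelow→∈ s in g m p)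

  ≤G-elimˡ : ∀ {GL GR HL HR g} → ⟨ GL ∣ GR ⟩ ≤G ⟨ HL ∣ HR ⟩ → g ∈ GL → ¬ (⟨ HL ∣ HR ⟩ ≤G g)
  ≤G-elimˡ (a , _) m p = a (∈→someLeftAbove m p)

  ≤G-elimʳ : ∀ {GL GR HL HR h} → ⟨ GL ∣ GR ⟩ ≤G ⟨ HL ∣ HR ⟩ → h ∈ HR → ¬ (h ≤G ⟨ GL ∣ GR ⟩)
  ≤G-elimʳ (_ , b) m p = b (∈→someRightBelow m p)

  mutual
    ≤G-refl : ∀ G → G ≤G G
    ≤G-refl ⟨ GL ∣ GR ⟩ = noLeftAbove GL (λ m → m) , noRightBelow GR (λ m → m)

    private
      noLeftAbove : ∀ {GL GR} gs → (∀ {g} → g ∈ gs → g ∈ GL) → ¬ someLeftAbove gs ⟨ GL ∣ GR ⟩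
      noLeftAbove (g@(⟨ _ ∣ _ ⟩) ∷ gs) sub (inj₁ p) = proj₁ p (∈→someLeftAbove (sub (here refl)) (≤G-refl g))
      noLeftAbove (g ∷ gs) sub (inj₂ p) = noLeftAbove gs (λ m → sub (there m)) p

      noRightBelow : ∀ {GL GR} hs → (∀ {h} → h ∈ hs → h ∈ GR) → ¬ someRightBelow hs ⟨ GL ∣ GR ⟩
      noRightBelow (h@(⟨ _ ∣ _ ⟩) ∷ hs) sub (inj₁ p) = proj₂ p (∈→someRightBelow (sub (here refl)) (≤G-refl h))
      noRightBelow (h ∷ hs) sub (inj₂ p) = noRightBelow hs (λ m → sub (there m)) p

  ≰leftOption : ∀ {GL GR g} → g ∈ GL → ¬ (⟨ GL ∣ GR ⟩ ≤G g)
  ≰leftOption {GL} {GR} = ≤G-elimˡ (≤G-refl ⟨ GL ∣ GR ⟩)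

  rightOption≰ : ∀ {GL GR h} → h ∈ GR → ¬ (h ≤G ⟨ GL ∣ GR ⟩)
  rightOption≰ {GL} {GR} = ≤G-elimʳ (≤G-refl ⟨ GL ∣ GR ⟩)

  mutual
    birthday : Game → ℕ
    birthday ⟨ L ∣ R ⟩ = suc (birthdays L ⊔ birthdays R)

    birthdays : List Game → ℕ
    birthdays [] = 0
    birthdays (g ∷ gs) = birthday g ⊔ birthdays gs

  birthday≤birthdays : ∀ {g gs} → g ∈ gs → birthday g ≤ birthdays gs
  birthday≤birthdays {gs = g ∷ gs} (here refl) = m≤m⊔n (birthday g) (birthdays gs)
  birthday≤birthdays {gs = h ∷ gs} (there m) = ≤-trans (birthday≤birthdays m) (m≤n⊔m (birthday h) (birthdays gs))

  birthday-leftOption : ∀ {g L R} → g ∈ L → birthday g < birthday ⟨ L ∣ R ⟩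
  birthday-leftOption {L = L} {R} m = s≤s (≤-trans (birthday≤birthdays m) (m≤m⊔n (birthdays L) (birthdays R)))

  birthday-rightOption : ∀ {g L R} → g ∈ R → birthday g < birthday ⟨ L ∣ R ⟩
  birthday-rightOption {L = L} {R} m = s≤s (≤-trans (birthday≤birthdays m) (m≤n⊔m (birthdays L) (birthdays R)))

  -- Transitivity by induction on the sum of the three birthdays, which drops at each recursive call.
  private
    ≤G-trans-bounded : ∀ n G H K → birthday G + birthday H + birthday K < n → G ≤G H → H ≤G K → G ≤G K
    ≤G-trans-bounded (suc n) G@(⟨ GL ∣ GR ⟩) H@(⟨ _ ∣ _ ⟩) K@(⟨ KL ∣ KR ⟩) bound G≤H H≤K = ≤G-intro viaLeft viaRight
      where
      viaLeft : ∀ {x} → x ∈ GL → ¬ (K ≤G x)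
      viaLeft {x} m K≤x = ≤G-elimˡ G≤H m (≤G-trans-bounded n H K x smaller H≤K K≤x)
        where
        smaller : birthday H + birthday K + birthday x < n
        smaller = subst (_< n) (trans (+-assoc (birthday x) _ _) (+-comm (birthday x) _))
          (<-≤-trans (+-monoˡ-< (birthday K) (+-monoˡ-< (birthday H) (birthday-leftOption {R = GR} m))) (≤-pred bound))
      viaRight : ∀ {y} → y ∈ KR → ¬ (y ≤G G)
      viaRight {y} m y≤G = ≤G-elimʳ H≤K m (≤G-trans-bounded n y G H smaller y≤G G≤H)
        where
        smaller : birthday y + birthday G + birthday H < n
        smaller = subst (_< n) (trans (+-comm (birthday G + birthday H) (birthday y)) (sym (+-assoc (birthday y) _ _)))
          (<-≤-trans (+-monoʳ-< (birthday G + birthday H) (birthday-rightOption {L = KL} m)) (≤-pred bound))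

  ≤G-trans : ∀ {G H K} → G ≤G H → H ≤G K → G ≤G K
  ≤G-trans {G} {H} {K} = ≤G-trans-bounded (suc (birthday G + birthday H + birthday K)) G H K ≤-refl

  ≈G-trans : ∀ {G H K} → G ≈G H → H ≈G K → G ≈G K
  ≈G-trans (G≤H , H≤G) (H≤K , K≤H) = ≤G-trans G≤H H≤K , ≤G-trans K≤H H≤G

  options : Player → Game → List Game
  options Left ⟨ L ∣ _ ⟩ = L
  options Right ⟨ _ ∣ R ⟩ = R

  options-η : ∀ G → ⟨ options Left G ∣ options Right G ⟩ ≡ G
  options-η ⟨ _ ∣ _ ⟩ = refl

  birthday-option : ∀ p {g G} → g ∈ options p G → birthday g < birthday G
  birthday-option Left {G = ⟨ _ ∣ R ⟩} = birthday-leftOption {R = R}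
  birthday-option Right {G = ⟨ L ∣ _ ⟩} = birthday-rightOption {L = L}

  mutual
    negInt : ℕ → Game
    negInt m = ⟨ [] ∣ negInts m ⟩

    negInts : ℕ → List Game
    negInts zero = []
    negInts (suc m) = negInt m ∷ negInts m

  mutual
    posInt : ℕ → Game
    posInt m = ⟨ posInts m ∣ [] ⟩

    posInts : ℕ → List Game
    posInts zero = []
    posInts (suc m) = posInt m ∷ posInts m

  negInt≤G : ∀ m K → birthday K ≤ m → negInt m ≤G K
  negInt≤G zero ⟨ _ ∣ _ ⟩ ()
  negInt≤G (suc m) ⟨ KL ∣ KR ⟩ born = ≤G-intro {[]} {negInts (suc m)} {KL} {KR} (λ ()) below
    where
    below : ∀ {k} → k ∈ KR → ¬ (k ≤G negInt (suc m))
    below {k@(⟨ _ ∣ _ ⟩)} mem k≤ =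
      ≤G-elimʳ k≤ (here refl) (negInt≤G m k (≤-pred (≤-trans (birthday-rightOption {L = KL} mem) born)))

  ≤G-posInt : ∀ m K → birthday K ≤ m → K ≤G posInt m
  ≤G-posInt zero ⟨ _ ∣ _ ⟩ ()
  ≤G-posInt (suc m) ⟨ KL ∣ KR ⟩ born = ≤G-intro {KL} {KR} {posInts (suc m)} {[]} above (λ ())
    where
    above : ∀ {k} → k ∈ KL → ¬ (posInt (suc m) ≤G k)
    above {k@(⟨ _ ∣ _ ⟩)} mem ≤k =
      ≤G-elimˡ ≤k (here refl) (≤G-posInt m k (≤-pred (≤-trans (birthday-leftOption {R = KR} mem) born)))

  ≈G-addLeftOptions : ∀ {v A B} (t : List Game) → ⟨ A ∣ B ⟩ ≈G v → (∀ {x} → x ∈ t → ¬ (v ≤G x)) →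
    ⟨ t ++ A ∣ B ⟩ ≈G v
  ≈G-addLeftOptions {v} {A} {B} t (≤v , v≤) harmless = ≤G-trans with≤without ≤v , ≤G-trans v≤ without≤with
    where
    with≤without : ⟨ t ++ A ∣ B ⟩ ≤G ⟨ A ∣ B ⟩
    with≤without = ≤G-intro bad rightOption≰
      where
      bad : ∀ {w} → w ∈ t ++ A → ¬ (⟨ A ∣ B ⟩ ≤G w)
      bad m p with ∈-++⁻ t m
      ... | inj₁ m∈t = harmless m∈t (≤G-trans v≤ p)
      ... | inj₂ m∈A = ≰leftOption m∈A p
    without≤with : ⟨ A ∣ B ⟩ ≤G ⟨ t ++ A ∣ B ⟩
    without≤with = ≤G-intro (λ m → ≰leftOption (∈-++⁺ʳ t m)) rightOption≰

  ≈G-addRightOptions : ∀ {v A B} (t : List Game) → ⟨ A ∣ B ⟩ ≈G v → (∀ {x} → x ∈ t → ¬ (x ≤G v)) →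
    ⟨ A ∣ t ++ B ⟩ ≈G v
  ≈G-addRightOptions {v} {A} {B} t (≤v , v≤) harmless = ≤G-trans with≤without ≤v , ≤G-trans v≤ without≤with
    where
    without≤with : ⟨ A ∣ B ⟩ ≤G ⟨ A ∣ t ++ B ⟩
    without≤with = ≤G-intro ≰leftOption bad
      where
      bad : ∀ {w} → w ∈ t ++ B → ¬ (w ≤G ⟨ A ∣ B ⟩)
      bad m p with ∈-++⁻ t m
      ... | inj₁ m∈t = harmless m∈t (≤G-trans p ≤v)
      ... | inj₂ m∈B = rightOption≰ m∈B p
    with≤without : ⟨ A ∣ t ++ B ⟩ ≤G ⟨ A ∣ B ⟩
    with≤without = ≤G-intro ≰leftOption (λ m → rightOption≰ (∈-++⁺ʳ t m))

  ≈G-byDomination : ∀ {VL VR A B} →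
    (∀ {x} → x ∈ A → ¬ (⟨ VL ∣ VR ⟩ ≤G x)) →
    (∀ {c} → c ∈ VL → ∃ λ x → x ∈ A × (c ≤G x)) →
    (∀ {y} → y ∈ B → ¬ (y ≤G ⟨ VL ∣ VR ⟩)) →
    (∀ {c} → c ∈ VR → ∃ λ y → y ∈ B × (y ≤G c)) →
    ⟨ A ∣ B ⟩ ≈G ⟨ VL ∣ VR ⟩
  ≈G-byDomination A⋡ VL⊑A B⋡ VR⊒B =
    ≤G-intro A⋡ (λ m p → let _ , y∈B , y≤c = VR⊒B m in rightOption≰ y∈B (≤G-trans y≤c p)) ,
    ≤G-intro (λ m p → let _ , x∈A , c≤x = VL⊑A m in ≰leftOption x∈A (≤G-trans p c≤x)) B⋡

module Canonical where

  open Order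
  open import Data.Product using (_×_; _,_; ∃; proj₁; proj₂)
  open import Data.List using (List; []; _∷_)
  open import Data.List.Relation.Unary.Any using (here; there; any?)
  open import Data.List.Relation.Unary.All as All using (All)
  open import Data.List.Relation.Unary.AllPairs using (AllPairs; []; _∷_)
  open import Data.List.Membership.Propositional using (_∈_; find; lose)
  open import Relation.Nullary using (¬_; Dec; yes; no)
  open import Relation.Nullary.Decidable using (_×-dec_; _⊎-dec_; ¬?)
  open import Relation.Binary.PropositionalEquality using (_≡_; refl; sym; subst)

  mutual
    _≤G?_ : ∀ G H → Dec (G ≤G H)
    ⟨ GL ∣ GR ⟩ ≤G? ⟨ HL ∣ HR ⟩ = ¬? (someLeftAbove? GL ⟨ HL ∣ HR ⟩) ×-dec ¬? (someRightBelow? HR ⟨ GL ∣ GR ⟩)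

    someLeftAbove? : ∀ gs H → Dec (someLeftAbove gs H)
    someLeftAbove? [] H = no λ ()
    someLeftAbove? (g ∷ gs) H = (H ≤G? g) ⊎-dec someLeftAbove? gs H

    someRightBelow? : ∀ hs G → Dec (someRightBelow hs G)
    someRightBelow? [] G = no λ ()
    someRightBelow? (h ∷ hs) G = (h ≤G? G) ⊎-dec someRightBelow? hs G

  -- On a ray the later options stay available, so no option may be dominated by a later one.
  Undominatedˡ Undominatedʳ : List Game → Set
  Undominatedˡ = AllPairs (λ k k′ → ¬ (k ≤G k′))
  Undominatedʳ = AllPairs (λ k k′ → ¬ (k′ ≤G k))

  pruneˡ : List Game → List Game
  pruneˡ [] = []
  pruneˡ (g ∷ gs) with any? (g ≤G?_) gs
  ... | yes _ = pruneˡ gs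
  ... | no _ = g ∷ pruneˡ gs

  pruneʳ : List Game → List Game
  pruneʳ [] = []
  pruneʳ (g ∷ gs) with any? (_≤G? g) gs
  ... | yes _ = pruneʳ gs
  ... | no _ = g ∷ pruneʳ gs

  pruneˡ-⊆ : ∀ {gs x} → x ∈ pruneˡ gs → x ∈ gs
  pruneˡ-⊆ {g ∷ gs} m with any? (g ≤G?_) gs
  ... | yes _ = there (pruneˡ-⊆ m)
  pruneˡ-⊆ {g ∷ gs} (here refl) | no _ = here refl
  pruneˡ-⊆ {g ∷ gs} (there m) | no _ = there (pruneˡ-⊆ m)

  pruneʳ-⊆ : ∀ {gs x} → x ∈ pruneʳ gs → x ∈ gs
  pruneʳ-⊆ {g ∷ gs} m with any? (_≤G? g) gs
  ... | yes _ = there (pruneʳ-⊆ m)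
  pruneʳ-⊆ {g ∷ gs} (here refl) | no _ = here refl
  pruneʳ-⊆ {g ∷ gs} (there m) | no _ = there (pruneʳ-⊆ m)

  pruneˡ-dominates : ∀ {gs g} → g ∈ gs → ∃ λ k → k ∈ pruneˡ gs × (g ≤G k)
  pruneˡ-dominates {g ∷ gs} m with any? (g ≤G?_) gs
  pruneˡ-dominates {g ∷ gs} (here refl) | yes g≤some =
    let k , k∈gs , g≤k = find g≤some ; k′ , k′∈ , k≤k′ = pruneˡ-dominates k∈gs in k′ , k′∈ , ≤G-trans g≤k k≤k′
  pruneˡ-dominates {g ∷ gs} (there m) | yes _ = pruneˡ-dominates m
  pruneˡ-dominates {g ∷ gs} (here refl) | no _ = g , here refl , ≤G-refl g
  pruneˡ-dominates {g ∷ gs} (there m) | no _ = let k , k∈ , p = pruneˡ-dominates m in k , there k∈ , p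

  pruneʳ-dominates : ∀ {gs g} → g ∈ gs → ∃ λ k → k ∈ pruneʳ gs × (k ≤G g)
  pruneʳ-dominates {g ∷ gs} m with any? (_≤G? g) gs
  pruneʳ-dominates {g ∷ gs} (here refl) | yes some≤g =
    let k , k∈gs , k≤g = find some≤g ; k′ , k′∈ , k′≤k = pruneʳ-dominates k∈gs in k′ , k′∈ , ≤G-trans k′≤k k≤g
  pruneʳ-dominates {g ∷ gs} (there m) | yes _ = pruneʳ-dominates m
  pruneʳ-dominates {g ∷ gs} (here refl) | no _ = g , here refl , ≤G-refl g
  pruneʳ-dominates {g ∷ gs} (there m) | no _ = let k , k∈ , p = pruneʳ-dominates m in k , there k∈ , p

  pruneˡ-undominated : ∀ gs → Undominatedˡ (pruneˡ gs)
  pruneˡ-undominated [] = []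
  pruneˡ-undominated (g ∷ gs) with any? (g ≤G?_) gs
  ... | yes _ = pruneˡ-undominated gs
  ... | no g≰all = All.tabulate (λ m p → g≰all (lose (pruneˡ-⊆ m) p)) ∷ pruneˡ-undominated gs

  pruneʳ-undominated : ∀ gs → Undominatedʳ (pruneʳ gs)
  pruneʳ-undominated [] = []
  pruneʳ-undominated (g ∷ gs) with any? (_≤G? g) gs
  ... | yes _ = pruneʳ-undominated gs
  ... | no all≰g = All.tabulate (λ m p → all≰g (lose (pruneʳ-⊆ m) p)) ∷ pruneʳ-undominated gs

  mutual
    reduce : Game → Game
    reduce ⟨ L ∣ R ⟩ = ⟨ pruneˡ (reduceAll L) ∣ pruneʳ (reduceAll R) ⟩

    reduceAll : List Game → List Game
    reduceAll [] = []
    reduceAll (g ∷ gs) = reduce g ∷ reduceAll gs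

  ∈-reduceAll⁻ : ∀ {gs x} → x ∈ reduceAll gs → ∃ λ g → g ∈ gs × (x ≡ reduce g)
  ∈-reduceAll⁻ {g ∷ gs} (here e) = g , here refl , e
  ∈-reduceAll⁻ {g ∷ gs} (there m) = let h , h∈ , e = ∈-reduceAll⁻ m in h , there h∈ , e

  ∈-reduceAll⁺ : ∀ {gs g} → g ∈ gs → reduce g ∈ reduceAll gs
  ∈-reduceAll⁺ (here refl) = here refl
  ∈-reduceAll⁺ (there m) = there (∈-reduceAll⁺ m)

  data Reduced : Game → Set where
    reduced : ∀ {L R} → Undominatedˡ L → Undominatedʳ R →
      (∀ {g} → g ∈ L → Reduced g) → (∀ {g} → g ∈ R → Reduced g) → Reduced ⟨ L ∣ R ⟩

  mutual
    reduce-≈G : ∀ G → reduce G ≈G G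
    reduce-≈G ⟨ L ∣ R ⟩ = ≤G-intro reducedL≰ R≰reduced , ≤G-intro L≰reduced reducedR≰
      where
      reducedL≰ : ∀ {k} → k ∈ pruneˡ (reduceAll L) → ¬ (⟨ L ∣ R ⟩ ≤G k)
      reducedL≰ m p with ∈-reduceAll⁻ (pruneˡ-⊆ m)
      ... | l , l∈L , refl = ≰leftOption l∈L (≤G-trans p (proj₁ (reduceAll-≈G L l∈L)))
      R≰reduced : ∀ {r} → r ∈ R → ¬ (r ≤G reduce ⟨ L ∣ R ⟩)
      R≰reduced m p = let k , k∈ , k≤ = pruneʳ-dominates (∈-reduceAll⁺ m) in
        rightOption≰ k∈ (≤G-trans k≤ (≤G-trans (proj₁ (reduceAll-≈G R m)) p))
      L≰reduced : ∀ {l} → l ∈ L → ¬ (reduce ⟨ L ∣ R ⟩ ≤G l)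
      L≰reduced m p = let k , k∈ , ≤k = pruneˡ-dominates (∈-reduceAll⁺ m) in
        ≰leftOption k∈ (≤G-trans p (≤G-trans (proj₂ (reduceAll-≈G L m)) ≤k))
      reducedR≰ : ∀ {h} → h ∈ pruneʳ (reduceAll R) → ¬ (h ≤G ⟨ L ∣ R ⟩)
      reducedR≰ m p with ∈-reduceAll⁻ (pruneʳ-⊆ m)
      ... | r , r∈R , refl = rightOption≰ r∈R (≤G-trans (proj₂ (reduceAll-≈G R r∈R)) p)

    reduceAll-≈G : ∀ gs {g} → g ∈ gs → reduce g ≈G g
    reduceAll-≈G (g ∷ gs) (here refl) = reduce-≈G g
    reduceAll-≈G (g ∷ gs) (there m) = reduceAll-≈G gs m

  mutual
    reduce-reduced : ∀ G → Reduced (reduce G)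
    reduce-reduced ⟨ L ∣ R ⟩ = reduced (pruneˡ-undominated (reduceAll L)) (pruneʳ-undominated (reduceAll R))
      (λ m → let l , l∈ , e = ∈-reduceAll⁻ (pruneˡ-⊆ m) in subst Reduced (sym e) (reduceAll-reduced L l∈))
      (λ m → let r , r∈ , e = ∈-reduceAll⁻ (pruneʳ-⊆ m) in subst Reduced (sym e) (reduceAll-reduced R r∈))

    reduceAll-reduced : ∀ gs {g} → g ∈ gs → Reduced (reduce g)
    reduceAll-reduced (g ∷ gs) (here refl) = reduce-reduced g
    reduceAll-reduced (g ∷ gs) (there m) = reduceAll-reduced gs m

module ShiftLemmas where

  open import Data.Nat using (suc)
  open import Data.Integer as ℤ using (+_)
  open import Data.Integer.Properties using (*-zeroˡ; +-identityʳ)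
  open import Data.Integer.Solver using (module +-*-Solver)
  open import Data.Product using (_,_)
  open import Relation.Binary.PropositionalEquality using (_≡_; refl; trans; cong; cong₂)

  shift-zero : ∀ c d → shift c d 0 ≡ c
  shift-zero (x , y) d = cong₂ _,_ (trans (cong (λ q → x ℤ.+ q) (*-zeroˡ (δx d))) (+-identityʳ x))
                                   (trans (cong (λ q → y ℤ.+ q) (*-zeroˡ (δy d))) (+-identityʳ y))

  shift-suc : ∀ c d j → shift (shift c d 1) d j ≡ shift c d (suc j)
  shift-suc (x , y) d j = cong₂ _,_ (step x (δx d) (+ j)) (step y (δy d) (+ j))
    where
    open +-*-Solver
    step : ∀ x δ J → (x ℤ.+ + 1 ℤ.* δ) ℤ.+ J ℤ.* δ ≡ x ℤ.+ (+ 1 ℤ.+ J) ℤ.* δ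
    step = solve 3 (λ x δ J → (x :+ con (+ 1) :* δ) :+ J :* δ := x :+ (con (+ 1) :+ J) :* δ) refl

-- Values of the cells of a layout in which every node has a Left ray and a Right ray with
-- gap cells between consecutive children, as a function of the node; m bounds all birthdays.
module RayValues (m : ℕ) (gap : Game → ℕ) where

  open Order
  open Canonical
  open import Data.Nat using (zero; suc; _≤_)
  open import Data.Nat.Properties using (≤-trans; <⇒≤)
  open import Data.Product using (_×_; _,_; ∃; proj₁; proj₂)
  open import Data.Sum using (_⊎_; inj₁; inj₂)
  open import Data.List using (List; []; _∷_; _++_)
  open import Data.List.Relation.Unary.Any using (here; there)
  import Data.List.Relation.Unary.All as All
  open import Data.List.Relation.Unary.AllPairs using (_∷_)
  open import Data.List.Membership.Propositional using (_∈_)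
  open import Relation.Nullary using (¬_)
  open import Relation.Binary.PropositionalEquality using (_≡_; refl)

  -- A gap cell on a Left ray: Left may run on along the ray, Right has the arm down to -(m+1).
  dummyˡ dummyʳ : List Game → Game
  dummyˡ r = ⟨ r ∣ negInts (suc m) ⟩
  dummyʳ r = ⟨ posInts (suc m) ∣ r ⟩

  padˡ padʳ : ℕ → List Game → List Game
  padˡ zero ys = ys
  padˡ (suc n) ys = dummyˡ (padˡ n ys) ∷ padˡ n ys
  padʳ zero ys = ys
  padʳ (suc n) ys = dummyʳ (padʳ n ys) ∷ padʳ n ys

  mutual
    ownRayˡ ownRayʳ : Game → List Game
    ownRayˡ v@(⟨ L ∣ _ ⟩) = rayˡ (gap v) L
    ownRayʳ v@(⟨ _ ∣ R ⟩) = rayʳ (gap v) R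

    rayˡ rayʳ : ℕ → List Game → List Game
    rayˡ g [] = []
    rayˡ g (c ∷ cs) = padˡ g (⟨ rayˡ g cs ++ ownRayˡ c ∣ ownRayʳ c ⟩ ∷ rayˡ g cs)
    rayʳ g [] = []
    rayʳ g (c ∷ cs) = padʳ g (⟨ ownRayˡ c ∣ rayʳ g cs ++ ownRayʳ c ⟩ ∷ rayʳ g cs)

  node : Game → Game
  node v = ⟨ ownRayˡ v ∣ ownRayʳ v ⟩

  nodeOnRayˡ nodeOnRayʳ : Game → List Game → Game
  nodeOnRayˡ c r = ⟨ r ++ ownRayˡ c ∣ ownRayʳ c ⟩
  nodeOnRayʳ c r = ⟨ ownRayˡ c ∣ r ++ ownRayʳ c ⟩

  ∈-padˡ⁻ : ∀ n {ys x} → x ∈ padˡ n ys → (∃ λ t → x ≡ dummyˡ t) ⊎ x ∈ ys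
  ∈-padˡ⁻ zero x∈ = inj₂ x∈
  ∈-padˡ⁻ (suc n) (here e) = inj₁ (_ , e)
  ∈-padˡ⁻ (suc n) (there x∈) = ∈-padˡ⁻ n x∈

  ∈-padʳ⁻ : ∀ n {ys x} → x ∈ padʳ n ys → (∃ λ t → x ≡ dummyʳ t) ⊎ x ∈ ys
  ∈-padʳ⁻ zero x∈ = inj₂ x∈
  ∈-padʳ⁻ (suc n) (here e) = inj₁ (_ , e)
  ∈-padʳ⁻ (suc n) (there x∈) = ∈-padʳ⁻ n x∈

  ∈-padˡ⁺ : ∀ n {ys x} → x ∈ ys → x ∈ padˡ n ys
  ∈-padˡ⁺ zero x∈ = x∈
  ∈-padˡ⁺ (suc n) x∈ = there (∈-padˡ⁺ n x∈)

  ∈-padʳ⁺ : ∀ n {ys x} → x ∈ ys → x ∈ padʳ n ys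
  ∈-padʳ⁺ zero x∈ = x∈
  ∈-padʳ⁺ (suc n) x∈ = there (∈-padʳ⁺ n x∈)

  dummyˡ-harmless : ∀ {c t} → birthday c ≤ m → ¬ (c ≤G dummyˡ t)
  dummyˡ-harmless {c@(⟨ _ ∣ _ ⟩)} born p = ≤G-elimʳ p (here refl) (negInt≤G m c born)

  dummyʳ-harmless : ∀ {c t} → birthday c ≤ m → ¬ (dummyʳ t ≤G c)
  dummyʳ-harmless {c@(⟨ _ ∣ _ ⟩)} born p = ≤G-elimˡ p (here refl) (≤G-posInt m c born)

  Admissible : Game → Set
  Admissible c = Reduced c × (birthday c ≤ m)

  admissible-leftOption : ∀ {L R c} → Admissible ⟨ L ∣ R ⟩ → c ∈ L → Admissible c
  admissible-leftOption {L} {R} (reduced _ _ sub _ , born) c∈ =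
    sub c∈ , ≤-trans (<⇒≤ (birthday-leftOption {L = L} {R} c∈)) born

  admissible-rightOption : ∀ {L R c} → Admissible ⟨ L ∣ R ⟩ → c ∈ R → Admissible c
  admissible-rightOption {L} {R} (reduced _ _ _ sub , born) c∈ =
    sub c∈ , ≤-trans (<⇒≤ (birthday-rightOption {L = L} {R} c∈)) born

  -- Each child is realised on its ray up to the later ray cells, which are harmless to it.
  mutual
    node-≈G : ∀ v → Admissible v → node v ≈G v
    node-≈G v@(⟨ L ∣ R ⟩) adm@(reduced undomL undomR _ _ , born) =
      ≈G-byDomination (rayˡ-harmless (gap v) L undomL (admissible-leftOption adm) born ≰leftOption)
                      (rayˡ-dominates (gap v) L undomL (admissible-leftOption adm))
                      (rayʳ-harmless (gap v) R undomR (admissible-rightOption adm) born rightOption≰)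
                      (rayʳ-dominates (gap v) R undomR (admissible-rightOption adm))

    nodeOnRayˡ-≈G : ∀ g c cs → Undominatedˡ (c ∷ cs) → (∀ {c′} → c′ ∈ c ∷ cs → Admissible c′) →
      nodeOnRayˡ c (rayˡ g cs) ≈G c
    nodeOnRayˡ-≈G g c cs (c⋡ ∷ undom) adm =
      ≈G-addLeftOptions (rayˡ g cs) (node-≈G c (adm (here refl)))
        (rayˡ-harmless g cs undom (λ m → adm (there m)) (proj₂ (adm (here refl))) (All.lookup c⋡))

    nodeOnRayʳ-≈G : ∀ g c cs → Undominatedʳ (c ∷ cs) → (∀ {c′} → c′ ∈ c ∷ cs → Admissible c′) →
      nodeOnRayʳ c (rayʳ g cs) ≈G c
    nodeOnRayʳ-≈G g c cs (c⋡ ∷ undom) adm =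
      ≈G-addRightOptions (rayʳ g cs) (node-≈G c (adm (here refl)))
        (rayʳ-harmless g cs undom (λ m → adm (there m)) (proj₂ (adm (here refl))) (All.lookup c⋡))

    rayˡ-harmless : ∀ g cs → Undominatedˡ cs → (∀ {c} → c ∈ cs → Admissible c) →
      ∀ {c′} → birthday c′ ≤ m → (∀ {c} → c ∈ cs → ¬ (c′ ≤G c)) → ∀ {x} → x ∈ rayˡ g cs → ¬ (c′ ≤G x)
    rayˡ-harmless g (c ∷ cs) undom@(_ ∷ undom′) adm born c′⋡ x∈ with ∈-padˡ⁻ g x∈
    ... | inj₁ (_ , refl) = dummyˡ-harmless born
    ... | inj₂ (here refl) = λ p → c′⋡ (here refl) (≤G-trans p (proj₁ (nodeOnRayˡ-≈G g c cs undom adm)))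
    ... | inj₂ (there x∈′) = rayˡ-harmless g cs undom′ (λ m → adm (there m)) born (λ m → c′⋡ (there m)) x∈′

    rayʳ-harmless : ∀ g cs → Undominatedʳ cs → (∀ {c} → c ∈ cs → Admissible c) →
      ∀ {c′} → birthday c′ ≤ m → (∀ {c} → c ∈ cs → ¬ (c ≤G c′)) → ∀ {x} → x ∈ rayʳ g cs → ¬ (x ≤G c′)
    rayʳ-harmless g (c ∷ cs) undom@(_ ∷ undom′) adm born c′⋡ x∈ with ∈-padʳ⁻ g x∈
    ... | inj₁ (_ , refl) = dummyʳ-harmless born
    ... | inj₂ (here refl) = λ p → c′⋡ (here refl) (≤G-trans (proj₂ (nodeOnRayʳ-≈G g c cs undom adm)) p)
    ... | inj₂ (there x∈′) = rayʳ-harmless g cs undom′ (λ m → adm (there m)) born (λ m → c′⋡ (there m)) x∈′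

    rayˡ-dominates : ∀ g cs → Undominatedˡ cs → (∀ {c} → c ∈ cs → Admissible c) →
      ∀ {c} → c ∈ cs → ∃ λ x → x ∈ rayˡ g cs × (c ≤G x)
    rayˡ-dominates g (c ∷ cs) undom adm (here refl) =
      _ , ∈-padˡ⁺ g (here refl) , proj₂ (nodeOnRayˡ-≈G g c cs undom adm)
    rayˡ-dominates g (c ∷ cs) (_ ∷ undom) adm (there c∈) =
      let x , x∈ , p = rayˡ-dominates g cs undom (λ m → adm (there m)) c∈ in x , ∈-padˡ⁺ g (there x∈) , p

    rayʳ-dominates : ∀ g cs → Undominatedʳ cs → (∀ {c} → c ∈ cs → Admissible c) →
      ∀ {c} → c ∈ cs → ∃ λ y → y ∈ rayʳ g cs × (y ≤G c)
    rayʳ-dominates g (c ∷ cs) undom adm (here refl) =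
      _ , ∈-padʳ⁺ g (here refl) , proj₁ (nodeOnRayʳ-≈G g c cs undom adm)
    rayʳ-dominates g (c ∷ cs) (_ ∷ undom) adm (there c∈) =
      let y , y∈ , p = rayʳ-dominates g cs undom (λ m → adm (there m)) c∈ in y , ∈-padʳ⁺ g (there y∈) , p

-- A single piece on a board whose cells are indexed by addresses: from a cell, the cells a piece
-- can reach in direction d form the list of addresses 'ray a d', all reachable by the same player.
module RayBoard
  (Address : Set) (cell : Address → Cell) (ray : Address → Dir → Player × List Address)
  (value : Address → Game) (Valid : Address → Set) (boardRooms : List Cell) (paint : Cell → Dir → Colour)
  (cell-injective : ∀ {a b} → Valid a → Valid b → cell a ≡ cell b → a ≡ b)
  (cell-room : ∀ {a} → Valid a → cell a ∈ boardRooms)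
  (paint-ray : ∀ {a d p t ts} → Valid a → ray a d ≡ (p , t ∷ ts) → paint (cell a) d ≡ colourOf p)
  (paint-noRay : ∀ {a d p} → Valid a → ray a d ≡ (p , []) → paint (cell a) d ≡ black)
  (ray-step : ∀ {a d p t ts} → Valid a → ray a d ≡ (p , t ∷ ts) →
    Valid t × (cell t ≡ shift (cell a) d 1) × (ray t d ≡ (p , ts)))
  (options-ray : ∀ p {a} → Valid a → ∀ {g} → g ∈ Order.options p (value a) →
    ∃ λ d → ∃ λ ts → ∃ λ t → (ray a d ≡ (p , ts)) × (t ∈ ts) × (g ≡ value t))
  (ray-options : ∀ p {a d ts t} → Valid a → ray a d ≡ (p , ts) → t ∈ ts → value t ∈ Order.options p (value a))
  where

  open Order
  open ShiftLemmas
  open import Data.Nat using (zero; suc; _<_; _≤_; s≤s; z≤n)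
  open import Data.Nat.Properties using (<-trans; <-irrefl; <-≤-trans; ≤-pred)
  open import Data.Empty using (⊥-elim)
  open import Data.Sum using (inj₁; inj₂)
  open import Data.List.Relation.Unary.Any using (Any; here; there)
  open import Data.List.Relation.Unary.All using (All; tabulate)
  open import Data.List.Membership.Propositional using (lose)
  open import Data.List.Membership.Propositional.Properties using (∈-++⁻; ∈-map⁻; ∈-upTo⁻)
  open import Relation.Nullary using (¬_)

  pieceAt : Address → List Cell → State
  pieceAt a P = mkState boardRooms paint (cell a ∷ []) P

  -- Passed rooms belong to addresses of larger birthday than the current one, and hence than every
  -- address still reachable: the rule forbidding re-entry never blocks a move of the tree.
  Fresh : Address → List Cell → Set
  Fresh a P = ∀ {x} → x ∈ P → ∃ λ b → Valid b × (cell b ≡ x) × (birthday (value a) < birthday (value b))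

  PassedBy : Address → Address → Dir → ℕ → Set
  PassedBy t b d k = ∀ j → j < k →
    ∃ λ β → Valid β × (cell β ≡ shift (cell b) d j) × (birthday (value t) < birthday (value β))

  DoorOpen : Player → List Cell → Cell → Dir → ℕ → Set
  DoorOpen p P c d j = (shift c d j ∈ boardRooms) × (shift c d (suc j) ∈ boardRooms)
                     × (paint (shift c d j) d ≡ colourOf p) × ¬ (shift c d (suc j) ∈ P)

  colourOf≢black : ∀ p → ¬ (colourOf p ≡ black)
  colourOf≢black Left ()
  colourOf≢black Right ()

  colourOf-injective : ∀ p q → colourOf q ≡ colourOf p → q ≡ p
  colourOf-injective Left Left _ = refl
  colourOf-injective Right Right _ = refl
  colourOf-injective Left Right ()
  colourOf-injective Right Left ()

  ray-birthday : ∀ {b d p ts t} → Valid b → ray b d ≡ (p , ts) → t ∈ ts → birthday (value t) < birthday (value b)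
  ray-birthday {p = p} vb e t∈ = birthday-option p (ray-options p vb e t∈)

  ray-valid : ∀ {b d p ts t} → Valid b → ray b d ≡ (p , ts) → t ∈ ts → Valid t
  ray-valid {ts = _ ∷ _} vb e (here refl) = proj₁ (ray-step vb e)
  ray-valid {ts = _ ∷ _} vb e (there t∈) = let vt₁ , _ , e₁ = ray-step vb e in ray-valid vt₁ e₁ t∈

  private
    along : ∀ {b d p t₁ ts} → Valid b → ray b d ≡ (p , t₁ ∷ ts) → ∀ j → shift (cell t₁) d j ≡ shift (cell b) d (suc j)
    along {b} {d} vb e j = trans (cong (λ c → shift c d j) (proj₁ (proj₂ (ray-step vb e)))) (shift-suc (cell b) d j)

    paint-first : ∀ {b d p ts} → Valid b → ray b d ≡ (p , ts) → paint (shift (cell b) d 0) d ≡ paint (cell b) d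
    paint-first {b} {d} _ _ = cong (λ c → paint c d) (shift-zero (cell b) d)

    passedBy-cons : ∀ {b d p t₁ ts t k} → Valid b → ray b d ≡ (p , t₁ ∷ ts) →
      birthday (value t) < birthday (value b) → PassedBy t t₁ d k → PassedBy t b d (suc k)
    passedBy-cons {b} {d} vb e t<b past zero _ = b , vb , sym (shift-zero (cell b) d) , t<b
    passedBy-cons vb e t<b past (suc j) (s≤s j<k) =
      let β , vβ , eβ , l = past j j<k in β , vβ , trans eβ (along vb e j) , l

    firstDoor : ∀ {b d p t₁ ts} P → Valid b → Fresh b P → ray b d ≡ (p , t₁ ∷ ts) → DoorOpen p P (cell b) d 0
    firstDoor {b} {d} P vb fresh e =
      subst (_∈ boardRooms) (sym (shift-zero (cell b) d)) (cell-room vb) ,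
      subst (_∈ boardRooms) (proj₁ (proj₂ (ray-step vb e))) (cell-room vt₁) ,
      trans (paint-first vb e) (paint-ray vb e) ,
      λ t₁∈P → let β , vβ , eβ , b<β = fresh t₁∈P in
        <-irrefl refl (<-trans b<β (subst (λ γ → birthday (value γ) < birthday (value b))
          (sym (cell-injective vβ vt₁ (trans eβ (sym (proj₁ (proj₂ (ray-step vb e)))))))
          (ray-birthday vb e (here refl))))
      where vt₁ = proj₁ (ray-step vb e)

  move⇒rayCell : ∀ {p d} k {b ts} → Valid b → ray b d ≡ (p , ts) → 1 ≤ k →
    (∀ j → j < k → paint (shift (cell b) d j) d ≡ colourOf p) →
    ∃ λ t → (t ∈ ts) × (cell t ≡ shift (cell b) d k) × PassedBy t b d k
  move⇒rayCell {p} {d} (suc k) {b} {[]} vb e _ open′ =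
    ⊥-elim (colourOf≢black p (trans (sym (open′ 0 (s≤s z≤n))) (trans (paint-first vb e) (paint-noRay vb e))))
  move⇒rayCell {d = d} (suc zero) {b} {t₁ ∷ ts} vb e _ _ =
    t₁ , here refl , proj₁ (proj₂ (ray-step vb e)) ,
    passedBy-cons vb e (ray-birthday vb e (here refl)) (λ _ ())
  move⇒rayCell {p} {d} (suc (suc k)) {b} {t₁ ∷ ts} vb e _ open′ =
    let vt₁ , _ , e₁ = ray-step vb e
        t , t∈ , et , past = move⇒rayCell (suc k) vt₁ e₁ (s≤s z≤n)
                               (λ j j<k → trans (cong (λ c → paint c d) (along vb e j)) (open′ (suc j) (s≤s j<k)))
    in t , there t∈ , trans et (along vb e (suc k)) ,
       passedBy-cons vb e (<-trans (ray-birthday vt₁ e₁ t∈) (ray-birthday vb e (here refl))) past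

  rayCell⇒move : ∀ {p d b ts t} P → Valid b → Fresh b P → ray b d ≡ (p , ts) → t ∈ ts →
    ∃ λ k → (1 ≤ k) × (cell t ≡ shift (cell b) d k) × (∀ j → j < k → DoorOpen p P (cell b) d j) × PassedBy t b d k
  rayCell⇒move {d = d} {b} {t₁ ∷ ts} P vb fresh e (here refl) =
    1 , s≤s z≤n , proj₁ (proj₂ (ray-step vb e)) ,
    (λ { zero _ → firstDoor P vb fresh e ; (suc _) (s≤s ()) }) ,
    passedBy-cons vb e (ray-birthday vb e (here refl)) (λ _ ())
  rayCell⇒move {p} {d} {b} {t₁ ∷ ts} {t} P vb fresh e (there t∈) =
    suc k , s≤s z≤n , trans et (along vb e k) , doors ,
    passedBy-cons vb e (<-trans (ray-birthday vt₁ e₁ t∈) t₁<b) past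
    where
    vt₁ = proj₁ (ray-step vb e)
    e₁ = proj₂ (proj₂ (ray-step vb e))
    t₁<b = ray-birthday vb e (here refl)
    fresh₁ : Fresh t₁ P
    fresh₁ x∈ = let β , vβ , eβ , b<β = fresh x∈ in β , vβ , eβ , <-trans t₁<b b<β
    rest = rayCell⇒move P vt₁ fresh₁ e₁ t∈
    k = proj₁ rest
    et = proj₁ (proj₂ (proj₂ rest))
    past = proj₂ (proj₂ (proj₂ (proj₂ rest)))
    doors : ∀ j → j < suc k → DoorOpen p P (cell b) d j
    doors zero _ = firstDoor P vb fresh e
    doors (suc j) (s≤s j<k) =
      let r₁ , r₂ , c , np = proj₁ (proj₂ (proj₂ (proj₂ rest))) j j<k in
      subst (_∈ boardRooms) (along vb e j) r₁ , subst (_∈ boardRooms) (along vb e (suc j)) r₂ ,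
      subst (λ c → paint c d ≡ colourOf p) (along vb e j) c , λ m → np (subst (_∈ P) (sym (along vb e (suc j))) m)

  pieceAt-value : ∀ n a P → birthday (value a) < n → Valid a → Fresh a P → IsValue (pieceAt a P) (value a)
  pieceAt-value (suc n) a P a<n va fresh = subst (IsValue (pieceAt a P)) (options-η (value a))
      (val (options Left (value a)) (options Right (value a))
           (movesAreOptions Left) (optionsAreMoves Left) (movesAreOptions Right) (optionsAreMoves Right))
    where
    after : Dir → ℕ → List Cell
    after d k = P ++ map (shift (cell a) d) (upTo k)

    fresh′ : ∀ {t d k} → birthday (value t) < birthday (value a) → PassedBy t a d k → Fresh t (after d k)
    fresh′ {t} {d} {k} t<a past x∈ with ∈-++⁻ P x∈
    ... | inj₁ x∈P = let β , vβ , eβ , l = fresh x∈P in β , vβ , eβ , <-trans t<a l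
    ... | inj₂ x∈new = let j , j∈ , ej = ∈-map⁻ (shift (cell a) d) x∈new
                           β , vβ , eβ , l = past j (∈-upTo⁻ j∈) in β , vβ , trans eβ (sym ej) , l

    valueAfter : ∀ {p d ts t k} → ray a d ≡ (p , ts) → t ∈ ts → cell t ≡ shift (cell a) d k → PassedBy t a d k →
      IsValue (mkState boardRooms paint (shift (cell a) d k ∷ []) (after d k)) (value t)
    valueAfter {d = d} {k = k} e t∈ et past =
      subst (λ c → IsValue (mkState boardRooms paint (c ∷ []) (after d k)) _) et
        (pieceAt-value n _ (after d k) (<-≤-trans (ray-birthday va e t∈) (≤-pred a<n)) (ray-valid va e t∈)
          (fresh′ (ray-birthday va e t∈) past))

    movesAreOptions : ∀ p s′ → Move p (pieceAt a P) s′ → Any (IsValue s′) (options p (value a))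
    movesAreOptions p _ (move [] [] _ d k refl 1≤k doors) with ray a d in e
    ... | q , [] = ⊥-elim (colourOf≢black p
          (trans (sym (proj₁ (proj₂ (proj₂ (doors 0 1≤k))))) (trans (paint-first va e) (paint-noRay va e))))
    ... | q , t₁ ∷ ts with colourOf-injective p q
          (trans (sym (paint-ray va e)) (trans (sym (paint-first va e)) (proj₁ (proj₂ (proj₂ (doors 0 1≤k))))))
    ... | refl = let t , t∈ , et , past = move⇒rayCell k va e 1≤k (λ j j<k → proj₁ (proj₂ (proj₂ (doors j j<k)))) in
                 lose (ray-options p va e t∈) (valueAfter e t∈ et past)
    movesAreOptions p _ (move (_ ∷ []) _ _ _ _ () _ _)
    movesAreOptions p _ (move (_ ∷ _ ∷ _) _ _ _ _ () _ _)

    optionsAreMoves : ∀ p → All (λ g → ∃ λ s′ → Move p (pieceAt a P) s′ × IsValue s′ g) (options p (value a))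
    optionsAreMoves p = tabulate λ g∈ →
      let d , ts , t , e , t∈ , eg = options-ray p va g∈
          k , 1≤k , et , doors , past = rayCell⇒move P va fresh e t∈
      in _ , move [] [] (cell a) d k refl 1≤k doors , subst (IsValue _) (sym eg) (valueAfter e t∈ et past)

module IntegerLemmas where

  open import Data.Nat as N using (zero; suc; _+_; _∸_; _≤_; _<_)
  import Data.Nat.Properties as NP
  open import Data.Integer as Z using (ℤ; +_; -[1+_]; ∣_∣; _⊖_)
  import Data.Integer.Properties as ZP
  open import Data.Bool using (Bool; true; false; not; _xor_)
  open import Data.Product using (_×_; _,_)
  open import Data.Empty using (⊥; ⊥-elim)
  open import Relation.Nullary using (¬_; yes; no)
  open import Relation.Binary.PropositionalEquality using (_≡_; _≢_; refl; sym; trans; cong; subst)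

  +≢negative : ∀ {N k} → 0 < k → ¬ (+ N ≡ Z.- (+ k))
  +≢negative {k = suc _} _ ()

  negateIf : Bool → ℤ → ℤ
  negateIf false x = x
  negateIf true x = Z.- x

  isNegative : ℤ → Bool
  isNegative (+ _) = false
  isNegative -[1+ _ ] = true

  negateIf-involutive : ∀ b x → negateIf b (negateIf b x) ≡ x
  negateIf-involutive false x = refl
  negateIf-involutive true x = ZP.neg-involutive x

  negateIf-+ : ∀ b x y → negateIf b (x Z.+ y) ≡ negateIf b x Z.+ negateIf b y
  negateIf-+ false x y = refl
  negateIf-+ true x y = ZP.neg-distrib-+ x y

  negateIf-zero : ∀ b → negateIf b (+ 0) ≡ + 0
  negateIf-zero false = refl
  negateIf-zero true = refl

  negateIf≡0 : ∀ b x → negateIf b x ≡ + 0 → x ≡ + 0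
  negateIf≡0 false x e = e
  negateIf≡0 true x e = trans (sym (ZP.neg-involutive x)) (cong Z.-_ e)

  +-rearrange : ∀ a b c d → a Z.+ b ≡ c Z.+ d → a ≡ c Z.+ (d Z.- b)
  +-rearrange a b c d e' = trans (sym (trans (ZP.+-assoc a b (Z.- b))
      (trans (cong (λ q → a Z.+ q) (ZP.+-inverseʳ b)) (ZP.+-identityʳ a))))
                       (trans (cong (Z._- b) e') (ZP.+-assoc c d (Z.- b)))

  xor-identityʳ : ∀ b → b xor false ≡ b
  xor-identityʳ true = refl
  xor-identityʳ false = refl

  ∣negateIf∣ : ∀ b x → ∣ negateIf b x ∣ ≡ ∣ x ∣
  ∣negateIf∣ false x = refl
  ∣negateIf∣ true x = ZP.∣-i∣≡∣i∣ x

  isNegative-negateIf-suc : ∀ b n → isNegative (negateIf b (+ suc n)) ≡ b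
  isNegative-negateIf-suc false n = refl
  isNegative-negateIf-suc true n = refl

  negateIf-suc≢0 : ∀ b n → negateIf b (+ suc n) ≢ + 0
  negateIf-suc≢0 false n ()
  negateIf-suc≢0 true n ()

  ∣negateIf-suc∣ : ∀ b n → ∣ negateIf b (+ suc n) ∣ ≡ suc n
  ∣negateIf-suc∣ b n = ∣negateIf∣ b (+ suc n)

  negateIf-suc-injective : ∀ b b' n n' → negateIf b (+ suc n) ≡ negateIf b' (+ suc n') → (b ≡ b') × (n ≡ n')
  negateIf-suc-injective false false n n' refl = refl , refl
  negateIf-suc-injective true true n n' refl = refl , refl
  negateIf-suc-injective false true n n' ()
  negateIf-suc-injective true false n n' ()

  negateIf-injective : ∀ b x y → negateIf b x ≡ negateIf b y → x ≡ y
  negateIf-injective b x y e = trans (sym (negateIf-involutive b x))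
      (trans (cong (negateIf b) e) (negateIf-involutive b y))

  close-naturals : ∀ N M x R → + N ≡ + M Z.+ x → ∣ x ∣ ≤ R → (N ≤ M + R) × (M ≤ N + R) × (N ≡ M → x ≡ + 0)
  close-naturals N M (+ n) R e l with ZP.+-injective e
  ... | refl = NP.+-monoʳ-≤ M l , NP.≤-trans (NP.m≤m+n M n) (NP.m≤m+n (M + n) R) ,
               λ M+n≡M → cong +_ (NP.+-cancelˡ-≡ M n 0 (trans M+n≡M (sym (NP.+-identityʳ M))))
  close-naturals N M -[1+ n ] R e l with suc n N.≤? M
  ... | yes n<M = NP.≤-trans (NP.≤-reflexive N≡M∸n) (NP.≤-trans (NP.m∸n≤m M (suc n)) (NP.m≤m+n M R)) ,
                  NP.≤-trans (NP.≤-reflexive M≡N+n) (NP.+-monoʳ-≤ N l) ,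
                  λ N≡M → ⊥-elim (NP.m≢1+m+n N (trans N≡M (trans M≡N+n (NP.+-suc N n))))
    where
    N≡M∸n : N ≡ M ∸ suc n
    N≡M∸n = ZP.+-injective (trans e (ZP.≤-⊖ n<M))
    M≡N+n : M ≡ N + suc n
    M≡N+n = trans (sym (NP.m∸n+n≡m n<M)) (cong (_+ suc n) (sym N≡M∸n))
  ... | no n≮M = ⊥-elim (+≢negative (NP.m<n⇒0<n∸m (NP.≰⇒> n≮M)) (trans e (ZP.⊖-≰ n≮M)))

  ∣D+x∣-lower : ∀ D x R → ∣ x ∣ ≤ R → D ≤ ∣ + D Z.+ x ∣ + R
  ∣D+x∣-lower D x R l = NP.≤-trans (NP.≤-reflexive (cong ∣_∣ (sym e)))
      (NP.≤-trans (ZP.∣i-j∣≤∣i∣+∣j∣ (+ D Z.+ x) x) (NP.+-monoʳ-≤ ∣ + D Z.+ x ∣ l))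
    where
    e : + D Z.+ x Z.- x ≡ + D
    e = trans (ZP.+-assoc (+ D) x (Z.- x)) (trans (cong (λ q → + D Z.+ q) (ZP.+-inverseʳ x))
        (ZP.+-identityʳ (+ D)))

  isNegative-+large : ∀ X x → ∣ x ∣ < X → isNegative (+ X Z.+ x) ≡ false
  isNegative-+large X (+ n) l = refl
  isNegative-+large X -[1+ n ] l = cong isNegative (ZP.≤-⊖ (NP.<⇒≤ l))

  isNegative-negateIf-nonneg : ∀ b y → y ≢ + 0 → isNegative y ≡ false → isNegative (negateIf b y) ≡ b
  isNegative-negateIf-nonneg false (+ n) nz _ = refl
  isNegative-negateIf-nonneg true (+ zero) nz _ = ⊥-elim (nz refl)
  isNegative-negateIf-nonneg true (+ suc n) nz _ = refl
  isNegative-negateIf-nonneg b -[1+ n ] nz ()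

  +large≢0 : ∀ X x → ∣ x ∣ < X → + X Z.+ x ≢ + 0
  +large≢0 X x l e = NP.<-irrefl (trans (cong ∣_∣ ex) (ZP.∣-i∣≡∣i∣ (+ X))) l
    where
    ex : x ≡ Z.- (+ X)
    ex = trans (sym (ZP.+-identityˡ x)) (trans (cong (Z._+ x) (sym (ZP.+-inverseˡ (+ X))))
        (trans (ZP.+-assoc (Z.- (+ X)) (+ X) x) (trans (cong (λ q → Z.- (+ X) Z.+ q) e) (ZP.+-identityʳ _))))

  isNegative-negateIf-large : ∀ b X u → ∣ u ∣ < X → isNegative (negateIf b (+ X) Z.+ u) ≡ b
  isNegative-negateIf-large b X u l = trans (cong isNegative e) (isNegative-negateIf-nonneg b
      (+ X Z.+ negateIf b u) (+large≢0 X (negateIf b u) l') (isNegative-+large X (negateIf b u) l'))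
    where
    l' : ∣ negateIf b u ∣ < X
    l' = subst (_< X) (sym (∣negateIf∣ b u)) l
    e : negateIf b (+ X) Z.+ u ≡ negateIf b (+ X Z.+ negateIf b u)
    e = trans (cong (λ q → negateIf b (+ X) Z.+ q) (sym (negateIf-involutive b u)))
        (sym (negateIf-+ b (+ X) (negateIf b u)))

  isNegative-negateIf : ∀ b x → x ≢ + 0 → isNegative (negateIf b x) ≡ b xor isNegative x
  isNegative-negateIf false x nz = refl
  isNegative-negateIf true (+ zero) nz = ⊥-elim (nz refl)
  isNegative-negateIf true (+ suc n) nz = refl
  isNegative-negateIf true -[1+ n ] nz = refl

  isNegative-of-< : ∀ N M x → + N ≡ + M Z.+ x → N < M → isNegative x ≡ true
  isNegative-of-< N M (+ n) e l with ZP.+-injective e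
  ... | refl = ⊥-elim (NP.<-irrefl refl (NP.<-≤-trans l (NP.m≤m+n M n)))
  isNegative-of-< N M -[1+ n ] e l = refl

  nonNegative-of-> : ∀ N M x → + N ≡ + M Z.+ x → M < N → isNegative x ≡ false
  nonNegative-of-> N M (+ n) e l = refl
  nonNegative-of-> N M -[1+ n ] e l with suc n N.≤? M
  ... | yes le = ⊥-elim (NP.<-irrefl refl (NP.<-≤-trans l (NP.≤-trans
      (NP.≤-reflexive (ZP.+-injective (trans e (ZP.≤-⊖ le)))) (NP.m∸n≤m M (suc n)))))
  ... | no n≮M = ⊥-elim (+≢negative (NP.m<n⇒0<n∸m (NP.≰⇒> n≮M)) (trans e (ZP.⊖-≰ n≮M)))

  armSide-before : ∀ σ ns o → ns xor true ≡ not ((σ xor o) xor not (σ xor (ns xor o))) → ⊥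
  armSide-before true true true ()
  armSide-before true true false ()
  armSide-before true false true ()
  armSide-before true false false ()
  armSide-before false true true ()
  armSide-before false true false ()
  armSide-before false false true ()
  armSide-before false false false ()

  armSide-after : ∀ σ ns o → ns xor false ≡ not ((σ xor o) xor not (σ xor (ns xor not o))) → ⊥
  armSide-after true true true ()
  armSide-after true true false ()
  armSide-after true false true ()
  armSide-after true false false ()
  armSide-after false true true ()
  armSide-after false true false ()
  armSide-after false false true ()
  armSide-after false false false ()


module NatLemmas where

  open import Data.Nat as N using (suc; _+_; _*_; _≤_; _<_; s≤s)
  open import Data.Nat.Properties as NP
  open import Data.Product using (_×_; _,_)
  open import Data.Sum using (_⊎_; inj₁; inj₂)
  open import Data.Empty using (⊥-elim)
  open import Relation.Binary.PropositionalEquality using (_≡_; refl; sym; trans; cong)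
  open import Relation.Binary.Definitions using (tri<; tri≈; tri>)

  *-gap : ∀ S k k' → k < k' → k * S + S ≤ k' * S
  *-gap S k k' l = ≤-trans (≤-reflexive (+-comm (k * S) S)) (*-monoˡ-≤ S l)

  division-unique : ∀ S k j k' j' → j < S → j' < S → k * S + j ≡ k' * S + j' → (k ≡ k') × (j ≡ j')
  division-unique S k j k' j' lj lj' e with <-cmp k k'
  ... | tri≈ _ refl _ = refl , +-cancelˡ-≡ (k * S) j j' e
  ... | tri< l _ _ = ⊥-elim (<⇒≱ (<-≤-trans (+-monoʳ-< (k * S) lj) (≤-trans (*-gap S k k' l)
      (m≤m+n (k' * S) j'))) (≤-reflexive (sym e)))
  ... | tri> _ _ l = ⊥-elim (<⇒≱ (<-≤-trans (+-monoʳ-< (k' * S) lj')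
      (≤-trans (*-gap S k' k l) (m≤m+n (k * S) j))) (≤-reflexive e))

  open import Data.Nat.Solver using (module +-*-Solver)
  open +-*-Solver

  eqX : ∀ a g S → suc (a + g) + S ≡ suc (a + S + g)
  eqX = solve 3 (λ a g S → con 1 :+ (a :+ g) :+ S := con 1 :+ (a :+ S :+ g)) refl

  childPositions-gap : ∀ S g k k' → k < k' → suc (k * S + g) + S ≤ suc (k' * S + g)
  childPositions-gap S g k k' l = ≤-trans (≤-reflexive (eqX (k * S) g S)) (s≤s (+-monoˡ-≤ g (*-gap S k k' l)))

  near-childPositions-equal : ∀ S g R k k' → R + R < S → suc (k * S + g) ≤ suc (k' * S + g) + (R + R) → suc
      (k' * S + g) ≤ suc (k * S + g) + (R + R) → k ≡ k'
  near-childPositions-equal S g R k k' lR a b with <-cmp k k'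
  ... | tri≈ _ e _ = e
  ... | tri< l _ _ = ⊥-elim (<⇒≱ (+-monoʳ-< (suc (k * S + g)) lR) (≤-trans (childPositions-gap S g k k' l) b))
  ... | tri> _ _ l = ⊥-elim (<⇒≱ (+-monoʳ-< (suc (k' * S + g)) lR) (≤-trans (childPositions-gap S g k' k l) a))

  near-childPosition : ∀ S g R k j k' → j < g → g < S → R < S → suc (k * S + j) ≤ suc (k' * S + g) + R → suc
      (k' * S + g) ≤ suc (k * S + j) + R →
    (k ≡ k' × suc (k * S + j) < suc (k' * S + g)) ⊎ (k ≡ suc k' × suc (k' * S + g) < suc (k * S + j))
  near-childPosition S g R k j k' lj lg lR a b with <-cmp k k'
  ... | tri≈ _ refl _ = inj₁ (refl , s≤s (+-monoʳ-< (k * S) lj))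
  ... | tri< l _ _ = ⊥-elim (<⇒≱ (s≤s (+-mono-< (+-monoʳ-< (k * S) lj) lR))
      (≤-trans (childPositions-gap S g k k' l) b))
  ... | tri> _ _ l with <-cmp k (suc k')
  ...   | tri< l' _ _ = ⊥-elim (<⇒≱ l (≤-pred l'))
  ...   | tri≈ _ refl _ = inj₂ (refl , s≤s (≤-trans (+-monoʳ-< (k' * S) lg)
      (≤-trans (≤-reflexive (+-comm (k' * S) S)) (m≤m+n (S + k' * S) j))))
  ...   | tri> _ _ l' = ⊥-elim (<⇒≱ (s≤s (≤-trans (s≤s (≤-reflexive (+-assoc (k' * S) g R)))
      (≤-trans (+-monoʳ-< (k' * S) (+-mono-< lg lR)) (≤-trans (≤-reflexive
      (trans (sym (+-assoc (k' * S) S S)) (cong (_+ S) (+-comm (k' * S) S))))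
      (≤-trans (*-gap S (suc k') k l') (m≤m+n (k * S) j)))))) a)



module Layout (P0 : Game) where

  open Order
  open import Data.Nat as N using (ℕ; zero; suc; _+_; _*_; _∸_; _⊔_; _≤_; _<_; s≤s)
  open import Data.Integer as Z using (ℤ; +_)
  open import Data.List.Relation.Unary.Any using (here; there)
  open import Data.Bool using (Bool; true; false; if_then_else_; not; _xor_)
  open import Data.Product using (_×_; _,_; proj₁; proj₂)
  open import Data.List using (List; []; _∷_; map; length; drop)
  open import Data.Unit using (⊤)

  m : ℕ
  m = birthday P0

  armLength : ℕ
  armLength = suc m

  -- The layout of a node lies within |u| , |w| ≤ radius: its rays consist of at most (number of
  -- children) · period cells, beside which the layouts of the children and the arms stick out.
  mutual
    radius : Game → ℕ
    radius ⟨ L ∣ R ⟩ = let r = maxRadius L ⊔ maxRadius R in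
      (length L ⊔ length R) * suc (suc (r + r + armLength)) + r + armLength

    maxRadius : List Game → ℕ
    maxRadius [] = 0
    maxRadius (c ∷ cs) = radius c ⊔ maxRadius cs

  childRadius : Game → ℕ
  childRadius ⟨ L ∣ R ⟩ = maxRadius L ⊔ maxRadius R

  gap : Game → ℕ
  gap v = suc (childRadius v + childRadius v + armLength)

  period : Game → ℕ
  period v = suc (gap v)

  open RayValues m gap public

  nChildren : Player → Game → ℕ
  nChildren s v = length (options s v)

  leaf : Game
  leaf = ⟨ [] ∣ [] ⟩

  -- Out of range, nth returns ⟨ [] ∣ [] ⟩; it is only used below the length of the list.
  nth : List Game → ℕ → Game
  nth [] k = leaf
  nth (c ∷ cs) zero = c
  nth (c ∷ cs) (suc k) = nth cs k

  nth-∈ : ∀ cs k → k < length cs → nth cs k ∈ cs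
  nth-∈ (c ∷ cs) zero _ = here refl
  nth-∈ (c ∷ cs) (suc k) (s≤s l) = there (nth-∈ cs k l)

  child : Player → Game → ℕ → Game
  child s v k = nth (options s v) k

  isRight : Player → Bool
  isRight Left = false
  isRight Right = true

  opponent : Player → Player
  opponent Left = Right
  opponent Right = Left

  odd : ℕ → Bool
  odd zero = false
  odd (suc k) = not (odd k)

  -- An address relative to a node: the node itself, the j-th gap cell before its k-th child on the
  -- ray of player s, the t-th cell of the arm leaving that gap cell, or an address inside the k-th child.
  data Address : Set where
    root : Address
    gapCell : Player → ℕ → ℕ → Address
    armCell : Player → ℕ → ℕ → ℕ → Address
    inChild : Player → ℕ → Address → Address

  Valid : Game → Address → Set
  Valid v root = ⊤
  Valid v (gapCell s k j) = (k < nChildren s v) × (j < gap v)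
  Valid v (armCell s k j t) = (k < nChildren s v) × (j < gap v) × (t < armLength)
  Valid v (inChild s k α) = (k < nChildren s v) × Valid (child s v k) α

  -- A node has local coordinates (u , w): w runs along its rays, positive for Left and negative for
  -- Right, and u across them. A frame places these on the grid; children get frames turned a right angle.
  record Frame : Set where
    constructor frame
    field
      originX originY : ℤ
      horizontal : Bool
      parity : Bool
  open Frame public

  open IntegerLemmas using (negateIf) public

  place : Frame → ℤ × ℤ → Cell
  place (frame originX originY true _) (u , w) = (originX Z.+ w , originY Z.+ u)
  place (frame originX originY false _) (u , w) = (originX Z.+ u , originY Z.+ w)

  rayCoord : Player → ℕ → ℤ
  rayCoord s i = negateIf (isRight s) (+ suc i)

  -- The arms of segment k leave the ray on the side away from the cells of children k - 1 and k
  -- that lie within armLength of the ray; alternating the parity from child to child makes this possible.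
  armSign : Bool → Player → ℕ → Bool
  armSign σ s k = not (σ xor (isRight s xor odd k))

  childFrame : Frame → Game → Player → ℕ → Frame
  childFrame F v s k = frame (proj₁ o) (proj₂ o) (not (horizontal F)) (parity F xor odd k)
    where
    o = place F (+ 0 , rayCoord s (k * period v + gap v))

  enc : Frame → Game → Address → Cell
  enc F v root = place F (+ 0 , + 0)
  enc F v (gapCell s k j) = place F (+ 0 , rayCoord s (k * period v + j))
  enc F v (armCell s k j t) = place F (negateIf (armSign (parity F) s k) (+ suc t) , rayCoord s
      (k * period v + j))
  enc F v (inChild s k α) = enc (childFrame F v s k) (child s v k) α

  loc : Bool → Game → Address → ℤ × ℤ
  loc σ v root = (+ 0 , + 0)
  loc σ v (gapCell s k j) = (+ 0 , rayCoord s (k * period v + j))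
  loc σ v (armCell s k j t) = (negateIf (armSign σ s k) (+ suc t) , rayCoord s (k * period v + j))
  loc σ v (inChild s k α) = (proj₂ l , rayCoord s (k * period v + gap v) Z.+ proj₁ l)
    where
    l = loc (σ xor odd k) (child s v k) α

  rayDir : Bool → Player → Dir
  rayDir true Left = east
  rayDir true Right = west
  rayDir false Left = north
  rayDir false Right = south

  armDir : Bool → Bool → Dir
  armDir true false = north
  armDir true true = south
  armDir false false = east
  armDir false true = west

  sameDir : Dir → Dir → Bool
  sameDir north north = true
  sameDir south south = true
  sameDir east east = true
  sameDir west west = true
  sameDir _ _ = false

  gapCells : Player → ℕ → ℕ → ℕ → List Address → List Address
  gapCells s k j zero rest = rest
  gapCells s k j (suc n) rest = gapCell s k j ∷ gapCells s k (suc j) n rest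

  segments : Game → Player → ℕ → ℕ → List Address
  segments v s k zero = []
  segments v s k (suc c) = gapCells s k 0 (gap v) (inChild s k root ∷ segments v s (suc k) c)

  afterChild : Game → Player → ℕ → List Address
  afterChild v s k = segments v s (suc k) (nChildren s v ∸ suc k)

  afterGap : Game → Player → ℕ → ℕ → List Address
  afterGap v s k j = gapCells s k (suc j) (gap v ∸ suc j) (inChild s k root ∷ afterChild v s k)

  armFrom : Player → ℕ → ℕ → ℕ → ℕ → List Address
  armFrom s k j t zero = []
  armFrom s k j t (suc n) = armCell s k j t ∷ armFrom s k j (suc t) n

  inChildRay : Player → ℕ → Player × List Address → Player × List Address
  inChildRay s k (p , ts) = (p , map (inChild s k) ts)

  noRay : Player × List Address
  noRay = (Left , [])

  rootRay : Bool → Game → Dir → Player × List Address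
  rootRay a v d = if sameDir d (rayDir a Left) then (Left , segments v Left 0 (nChildren Left v))
                  else if sameDir d (rayDir a Right) then (Right , segments v Right 0 (nChildren Right v)) else noRay

  ray : Bool → Bool → Game → Address → Dir → Player × List Address
  ray a σ v root d = rootRay a v d
  ray a σ v (gapCell s k j) d = if sameDir d (rayDir a s) then (s , afterGap v s k j)
                            else if sameDir d (armDir a (armSign σ s k)) then
                                (opponent s , armFrom s k j 0 armLength) else noRay
  ray a σ v (armCell s k j t) d = if sameDir d (armDir a (armSign σ s k)) then
      (opponent s , armFrom s k j (suc t) (m ∸ t)) else noRay
  ray a σ v (inChild s k root) d = if sameDir d (rayDir a s) then (s , afterChild v s k)
                               else inChildRay s k (rootRay (not a) (child s v k) d)
  ray a σ v (inChild s k α) d = inChildRay s k (ray (not a) (σ xor odd k) (child s v k) α d)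

  rayOf : Player → ℕ → List Game → List Game
  rayOf Left = rayˡ
  rayOf Right = rayʳ

  nodeOnRay : Player → Game → List Game → Game
  nodeOnRay Left = nodeOnRayˡ
  nodeOnRay Right = nodeOnRayʳ

  dummy : Player → List Game → Game
  dummy Left = dummyˡ
  dummy Right = dummyʳ

  pad : Player → ℕ → List Game → List Game
  pad Left = padˡ
  pad Right = padʳ

  armValue : Player → ℕ → Game
  armValue Left = negInt
  armValue Right = posInt

  laterRay : Game → Player → ℕ → List Game
  laterRay v s k = rayOf s (gap v) (drop (suc k) (options s v))

  value : Game → Address → Game
  value v root = node v
  value v (gapCell s k j) = dummy s (pad s (gap v ∸ suc j) (nodeOnRay s (child s v k) (laterRay v s k) ∷
      laterRay v s k))
  value v (armCell s k j t) = armValue s (m ∸ t)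
  value v (inChild s k root) = nodeOnRay s (child s v k) (laterRay v s k)
  value v (inChild s k α) = value (child s v k) α


module LayoutValues (P0 : Game) where

  open Order
  open Layout P0
  open import Data.Nat as N using (ℕ; zero; suc; _+_; _∸_; _≤_; _<_; s≤s; z≤n)
  open import Data.Nat.Properties using (+-suc; m+[n∸m]≡n; m∸n≡0⇒m≤n; m+n∸m≡n; suc-injective)
  open import Data.Bool using (Bool; true; false; if_then_else_; not; _xor_)
  open import Data.Product using (_×_; _,_; proj₁; proj₂; ∃)
  open import Data.Sum using (inj₁; inj₂)
  open import Data.List using (List; []; _∷_; _++_; map; length; drop)
  open import Data.List.Relation.Unary.Any using (Any; here; there)
  open import Data.List.Membership.Propositional using (_∈_)
  open import Data.List.Membership.Propositional.Properties using (∈-map⁻; ∈-map⁺; ∈-++⁻; ∈-++⁺ˡ; ∈-++⁺ʳ)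
  open import Relation.Binary.PropositionalEquality using (_≡_; refl; sym; trans; cong; subst)
  open import Data.Empty using (⊥)

  sameDir-refl : ∀ d → sameDir d d ≡ true
  sameDir-refl north = refl
  sameDir-refl south = refl
  sameDir-refl east = refl
  sameDir-refl west = refl

  sameDir-armDir-rayDir : ∀ a b s → sameDir (armDir a b) (rayDir a s) ≡ false
  sameDir-armDir-rayDir true false Left = refl
  sameDir-armDir-rayDir true false Right = refl
  sameDir-armDir-rayDir true true Left = refl
  sameDir-armDir-rayDir true true Right = refl
  sameDir-armDir-rayDir false false Left = refl
  sameDir-armDir-rayDir false false Right = refl
  sameDir-armDir-rayDir false true Left = refl
  sameDir-armDir-rayDir false true Right = refl

  sameDir-turned-rayDir : ∀ a s s' → sameDir (rayDir (not a) s') (rayDir a s) ≡ false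
  sameDir-turned-rayDir true Left Left = refl
  sameDir-turned-rayDir true Left Right = refl
  sameDir-turned-rayDir true Right Left = refl
  sameDir-turned-rayDir true Right Right = refl
  sameDir-turned-rayDir false Left Left = refl
  sameDir-turned-rayDir false Left Right = refl
  sameDir-turned-rayDir false Right Left = refl
  sameDir-turned-rayDir false Right Right = refl

  sameDir-rayDir-Right-Left : ∀ a → sameDir (rayDir a Right) (rayDir a Left) ≡ false
  sameDir-rayDir-Right-Left true = refl
  sameDir-rayDir-Right-Left false = refl

  drop-nth : ∀ (cs : List Game) k → suc k N.≤ length cs → drop k cs ≡ nth cs k ∷ drop (suc k) cs
  drop-nth (c ∷ cs) zero _ = refl
  drop-nth (c ∷ cs) (suc k) (s≤s l) = drop-nth cs k l

  drop-beyond : ∀ (cs : List Game) k → length cs ≤ k → drop k cs ≡ []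
  drop-beyond [] zero _ = refl
  drop-beyond [] (suc k) _ = refl
  drop-beyond (c ∷ cs) (suc k) (s≤s l) = drop-beyond cs k l

  ∸≡suc⇒ : ∀ n k c → n ∸ k ≡ suc c → (suc k ≤ n) × (n ∸ suc k ≡ c)
  ∸≡suc⇒ (suc n) zero c refl = s≤s z≤n , refl
  ∸≡suc⇒ (suc n) (suc k) c e = let (a , b) = ∸≡suc⇒ n k c e in s≤s a , b

  mutual
    segments-values : ∀ v s k c → nChildren s v ∸ k ≡ c → map (value v) (segments v s k c) ≡ rayOf s (gap v)
        (drop k (options s v))
    segments-values v s k zero e = sym (trans (cong (rayOf s (gap v))
        (drop-beyond (options s v) k (m∸n≡0⇒m≤n e))) (rayOf-[] s))
      where
      rayOf-[] : ∀ s → rayOf s (gap v) [] ≡ []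
      rayOf-[] Left = refl
      rayOf-[] Right = refl
    segments-values v s k (suc c) e with ∸≡suc⇒ (nChildren s v) k c e
    ... | lt , e' = trans (gapCells-values v s k 0 (gap v) c refl e')
                         (sym (trans (cong (rayOf s (gap v)) (drop-nth (options s v) k lt)) (rayOf-∷ s)))
      where
      rayOf-∷ : ∀ s → rayOf s (gap v) (nth (options s v) k ∷ drop (suc k) (options s v)) ≡ pad s (gap v)
          (nodeOnRay s (child s v k) (laterRay v s k) ∷ laterRay v s k)
      rayOf-∷ Left = refl
      rayOf-∷ Right = refl

    gapCells-values : ∀ v s k j x c → j + x ≡ gap v → nChildren s v ∸ suc k ≡ c →
      map (value v) (gapCells s k j x (inChild s k root ∷ segments v s (suc k) c)) ≡ pad s x
          (nodeOnRay s (child s v k) (laterRay v s k) ∷ laterRay v s k)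
    gapCells-values v s k j zero c e e' = trans (cong (nodeOnRay s (child s v k) (laterRay v s k) ∷_)
        (segments-values v s (suc k) c e')) (sym (pad-zero s))
      where
      pad-zero : ∀ s {X} → pad s 0 X ≡ X
      pad-zero Left = refl
      pad-zero Right = refl
    gapCells-values v s k j (suc x) c e e' = trans (cong (_ ∷_) (gapCells-values v s k (suc j) x c
        (trans (sym (+-suc j x)) e) e')) (pad-suc s)
      where
      gap∸j≡x : gap v ∸ suc j ≡ x
      gap∸j≡x = trans (cong (_∸ suc j) (trans (sym e) (+-suc j x))) (m+n∸m≡n (suc j) x)
      pad-suc : ∀ s → value v (gapCell s k j) ∷ pad s x (nodeOnRay s (child s v k) (laterRay v s k) ∷ laterRay v s k)
                 ≡ pad s (suc x) (nodeOnRay s (child s v k) (laterRay v s k) ∷ laterRay v s k)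
      pad-suc Left = cong (λ q → dummyˡ (padˡ q (nodeOnRay Left (child Left v k) (laterRay v Left k) ∷ laterRay
          v Left k)) ∷ padˡ x (nodeOnRay Left (child Left v k) (laterRay v Left k) ∷ laterRay v Left k)) gap∸j≡x
      pad-suc Right = cong (λ q → dummyʳ (padʳ q (nodeOnRay Right (child Right v k) (laterRay v Right k) ∷
          laterRay v Right k)) ∷ padʳ x (nodeOnRay Right (child Right v k) (laterRay v Right k) ∷ laterRay v
          Right k)) gap∸j≡x

  ownEta : ∀ c → ownRayˡ c ≡ rayˡ (gap c) (options Left c)
  ownEta ⟨ L ∣ R ⟩ = refl

  ownEtaR : ∀ c → ownRayʳ c ≡ rayʳ (gap c) (options Right c)
  ownEtaR ⟨ L ∣ R ⟩ = refl

  rootRayˡ-values : ∀ c → map (value c) (segments c Left 0 (nChildren Left c)) ≡ ownRayˡ c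
  rootRayˡ-values c = trans (segments-values c Left 0 (nChildren Left c) refl) (sym (ownEta c))

  rootRayʳ-values : ∀ c → map (value c) (segments c Right 0 (nChildren Right c)) ≡ ownRayʳ c
  rootRayʳ-values c = trans (segments-values c Right 0 (nChildren Right c) refl) (sym (ownEtaR c))

  afterChild-values : ∀ v s k → map (value v) (afterChild v s k) ≡ laterRay v s k
  afterChild-values v s k = segments-values v s (suc k) (nChildren s v ∸ suc k) refl

  afterGap-values : ∀ v s k j → j < gap v → map (value v) (afterGap v s k j) ≡ pad s (gap v ∸ suc j)
      (nodeOnRay s (child s v k) (laterRay v s k) ∷ laterRay v s k)
  afterGap-values v s k j lt = gapCells-values v s k (suc j) (gap v ∸ suc j) (nChildren s v ∸ suc k)
      (m+[n∸m]≡n lt) refl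

  armValues : Player → ℕ → List Game
  armValues Left = negInts
  armValues Right = posInts

  armFrom-values : ∀ v s k j t n → t + n ≡ armLength → map (value v) (armFrom s k j t n) ≡ armValues s n
  armFrom-values v s k j t zero e = armValues-zero s
    where
    armValues-zero : ∀ s → [] ≡ armValues s 0
    armValues-zero Left = refl
    armValues-zero Right = refl
  armFrom-values v s k j t (suc n) e = trans (cong (value v (armCell s k j t) ∷_)
      (armFrom-values v s k j (suc t) n (trans (sym (+-suc t n)) e))) (armValues-suc s)
    where
    m∸t≡n : m ∸ t ≡ n
    m∸t≡n = trans (cong (_∸ t) (suc-injective (trans (sym e) (+-suc t n)))) (m+n∸m≡n t n)
    armValues-suc : ∀ s → armValue s (m ∸ t) ∷ armValues s n ≡ armValues s (suc n)
    armValues-suc Left = cong (λ q → negInt q ∷ negInts n) m∸t≡n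
    armValues-suc Right = cong (λ q → posInt q ∷ posInts n) m∸t≡n

  open import Data.Unit using (⊤; tt)

  NotRoot : Address → Set
  NotRoot root = ⊥
  NotRoot _ = ⊤

  AllNotRoot : List Address → Set
  AllNotRoot xs = ∀ {t} → t ∈ xs → NotRoot t

  ray-inChild : ∀ a σ v s k α d → NotRoot α → ray a σ v (inChild s k α) d ≡ inChildRay s k
      (ray (not a) (σ xor odd k) (child s v k) α d)
  ray-inChild a σ v s k (gapCell _ _ _) d _ = refl
  ray-inChild a σ v s k (armCell _ _ _ _) d _ = refl
  ray-inChild a σ v s k (inChild _ _ _) d _ = refl

  value-inChild : ∀ v s k α → NotRoot α → value v (inChild s k α) ≡ value (child s v k) α
  value-inChild v s k (gapCell _ _ _) _ = refl
  value-inChild v s k (armCell _ _ _ _) _ = refl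
  value-inChild v s k (inChild _ _ _) _ = refl

  gapCells-notRoot : ∀ s k j x rest → AllNotRoot rest → AllNotRoot (gapCells s k j x rest)
  gapCells-notRoot s k j zero rest h m = h m
  gapCells-notRoot s k j (suc x) rest h (here refl) = tt
  gapCells-notRoot s k j (suc x) rest h (there m) = gapCells-notRoot s k (suc j) x rest h m

  segments-notRoot : ∀ v s k c → AllNotRoot (segments v s k c)
  segments-notRoot v s k zero ()
  segments-notRoot v s k (suc c) = gapCells-notRoot s k 0 (gap v) _ h
    where
    h : AllNotRoot (inChild s k root ∷ segments v s (suc k) c)
    h (here refl) = tt
    h (there m) = segments-notRoot v s (suc k) c m

  armFrom-notRoot : ∀ s k j t n → AllNotRoot (armFrom s k j t n)
  armFrom-notRoot s k j t zero ()
  armFrom-notRoot s k j t (suc n) (here refl) = tt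
  armFrom-notRoot s k j t (suc n) (there m) = armFrom-notRoot s k j (suc t) n m

  map-inChild-notRoot : ∀ s k xs → AllNotRoot (map (inChild s k) xs)
  map-inChild-notRoot s k xs m with ∈-map⁻ (inChild s k) m
  ... | y , _ , refl = tt

  if-notRoot : ∀ (b : Bool) (X Y : Player × List Address) → AllNotRoot (proj₂ X) → AllNotRoot (proj₂ Y) →
      AllNotRoot (proj₂ (if b then X else Y))
  if-notRoot true X Y hx hy = hx
  if-notRoot false X Y hx hy = hy

  noRay-notRoot : AllNotRoot (proj₂ noRay)
  noRay-notRoot ()

  rootRay-notRoot : ∀ a v d → AllNotRoot (proj₂ (rootRay a v d))
  rootRay-notRoot a v d = if-notRoot (sameDir d (rayDir a Left)) _ _
      (segments-notRoot v Left 0 (nChildren Left v)) (if-notRoot (sameDir d (rayDir a Right)) _ _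
      (segments-notRoot v Right 0 (nChildren Right v)) noRay-notRoot)

  ray-notRoot : ∀ a σ v α d → AllNotRoot (proj₂ (ray a σ v α d))
  ray-notRoot a σ v root d = rootRay-notRoot a v d
  ray-notRoot a σ v (gapCell s k j) d = if-notRoot (sameDir d (rayDir a s)) _ _
      (gapCells-notRoot s k (suc j) (gap v ∸ suc j) (inChild s k root ∷ afterChild v s k) h)
      (if-notRoot (sameDir d (armDir a (armSign σ s k))) _ _ (armFrom-notRoot s k j 0 armLength) noRay-notRoot)
    where
    h : AllNotRoot (inChild s k root ∷ afterChild v s k)
    h (here refl) = tt
    h (there m) = segments-notRoot v s (suc k) (nChildren s v ∸ suc k) m
  ray-notRoot a σ v (armCell s k j t) d = if-notRoot (sameDir d (armDir a (armSign σ s k))) _ _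
      (armFrom-notRoot s k j (suc t) (m ∸ t)) noRay-notRoot
  ray-notRoot a σ v (inChild s k root) d = if-notRoot (sameDir d (rayDir a s)) _ _
      (segments-notRoot v s (suc k) (nChildren s v ∸ suc k)) (map-inChild-notRoot s k _)
  ray-notRoot a σ v (inChild s k (gapCell _ _ _)) d = map-inChild-notRoot s k _
  ray-notRoot a σ v (inChild s k (armCell _ _ _ _)) d = map-inChild-notRoot s k _
  ray-notRoot a σ v (inChild s k (inChild _ _ _)) d = map-inChild-notRoot s k _

  RayOption : Player → Bool → Bool → Game → Address → Game → Set
  RayOption p a σ v α g = ∃ λ d → ∃ λ ts → ∃ λ t → (ray a σ v α d ≡ (p , ts)) × (t ∈ ts) × (g ≡ value v t)

  rayOption : ∀ {a σ v α d p ts t g} → ray a σ v α d ≡ (p , ts) → t ∈ ts → g ≡ value v t → RayOption p a σ v α g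
  rayOption e m eg = _ , _ , _ , e , m , eg

  rootRay-Left : ∀ a v → rootRay a v (rayDir a Left) ≡ (Left , segments v Left 0 (nChildren Left v))
  rootRay-Left a v rewrite sameDir-refl (rayDir a Left) = refl

  rootRay-Right : ∀ a v → rootRay a v (rayDir a Right) ≡ (Right , segments v Right 0 (nChildren Right v))
  rootRay-Right a v rewrite sameDir-rayDir-Right-Left a | sameDir-refl (rayDir a Right) = refl

  ray-gapCell-along : ∀ a σ v s k j → ray a σ v (gapCell s k j) (rayDir a s) ≡ (s , afterGap v s k j)
  ray-gapCell-along a σ v s k j rewrite sameDir-refl (rayDir a s) = refl

  ray-gapCell-arm : ∀ a σ v s k j → ray a σ v (gapCell s k j) (armDir a (armSign σ s k)) ≡
      (opponent s , armFrom s k j 0 armLength)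
  ray-gapCell-arm a σ v s k j rewrite sameDir-armDir-rayDir a (armSign σ s k) s | sameDir-refl (armDir a (armSign σ s k)) = refl

  ray-armCell : ∀ a σ v s k j t → ray a σ v (armCell s k j t) (armDir a (armSign σ s k)) ≡
      (opponent s , armFrom s k j (suc t) (m ∸ t))
  ray-armCell a σ v s k j t rewrite sameDir-refl (armDir a (armSign σ s k)) = refl

  ray-childRoot-along : ∀ a σ v s k → ray a σ v (inChild s k root) (rayDir a s) ≡ (s , afterChild v s k)
  ray-childRoot-along a σ v s k rewrite sameDir-refl (rayDir a s) = refl

  ray-childRoot-turn : ∀ a σ v s k s' → ray a σ v (inChild s k root) (rayDir (not a) s') ≡ inChildRay s k
      (rootRay (not a) (child s v k) (rayDir (not a) s'))
  ray-childRoot-turn a σ v s k s' rewrite sameDir-turned-rayDir a s s' = refl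

  ray-childRoot-Left : ∀ a σ v s k → ray a σ v (inChild s k root) (rayDir (not a) Left) ≡
      (Left , map (inChild s k) (segments (child s v k) Left 0 (nChildren Left (child s v k))))
  ray-childRoot-Left a σ v s k = trans (ray-childRoot-turn a σ v s k Left)
      (cong (inChildRay s k) (rootRay-Left (not a) (child s v k)))

  ray-childRoot-Right : ∀ a σ v s k → ray a σ v (inChild s k root) (rayDir (not a) Right) ≡
      (Right , map (inChild s k) (segments (child s v k) Right 0 (nChildren Right (child s v k))))
  ray-childRoot-Right a σ v s k = trans (ray-childRoot-turn a σ v s k Right)
      (cong (inChildRay s k) (rootRay-Right (not a) (child s v k)))

  arm-remaining : ∀ {t} → t < armLength → suc t + (m ∸ t) ≡ armLength
  arm-remaining {t} (s≤s l) = cong suc (m+[n∸m]≡n l)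

  rayOption-map : ∀ {a σ v α d p xs g} → ray a σ v α d ≡ (p , xs) → g ∈ map (value v) xs → RayOption p a σ v α g
  rayOption-map {a} {σ} {v} {α} {d} e mg with ∈-map⁻ (value v) mg
  ... | t , mt , eg = rayOption {a} {σ} {v} {α} {d} e mt eg

  rayOption-inChild : ∀ p a σ v s k α g → NotRoot α → RayOption p (not a) (σ xor odd k) (child s v k) α g →
      RayOption p a σ v (inChild s k α) g
  rayOption-inChild p a σ v s k α g nh (d , ts , t , e , mt , eg) = d , map (inChild s k) ts , inChild s k t ,
      trans (ray-inChild a σ v s k α d nh) (cong (inChildRay s k) e) ,
    ∈-map⁺ (inChild s k) mt ,
    trans eg (sym (value-inChild v s k t (ray-notRoot (not a) (σ xor odd k) (child s v k) α d
        (subst (λ q → t ∈ proj₂ q) (sym e) mt))))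

  rayOption-childRoot : ∀ p a σ v s k s' g → (q : ray a σ v (inChild s k root) (rayDir (not a) s') ≡
      (p , map (inChild s k) (segments (child s v k) s' 0 (nChildren s' (child s v k))))) →
    g ∈ map (value (child s v k)) (segments (child s v k) s' 0 (nChildren s' (child s v k))) → RayOption p a σ
        v (inChild s k root) g
  rayOption-childRoot p a σ v s k s' g q mg with ∈-map⁻ (value (child s v k)) mg
  ... | t , mt , eg = rayOption {a} {σ} {v} {inChild s k root} {rayDir (not a) s'} q (∈-map⁺ (inChild s k) mt)
                        (trans eg (sym (value-inChild v s k t (segments-notRoot (child s v k) s' 0
                            (nChildren s' (child s v k)) mt))))

  options-rayOption : ∀ p a σ v α → Valid v α → ∀ {g} → g ∈ options p (value v α) → RayOption p a σ v α g
  options-rayOption Left a σ ⟨ L ∣ R ⟩ root _ {g} mg = rayOption-map {a} {σ} {⟨ L ∣ R ⟩} {root} {rayDir a Left}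
      (rootRay-Left a ⟨ L ∣ R ⟩) (subst (g ∈_) (sym (rootRayˡ-values ⟨ L ∣ R ⟩)) mg)
  options-rayOption Right a σ ⟨ L ∣ R ⟩ root _ {g} mg = rayOption-map {a} {σ} {⟨ L ∣ R ⟩} {root}
      {rayDir a Right} (rootRay-Right a ⟨ L ∣ R ⟩) (subst (g ∈_) (sym (rootRayʳ-values ⟨ L ∣ R ⟩)) mg)
  options-rayOption Left a σ v (gapCell Left k j) (_ , lj) {g} mg = rayOption-map {a} {σ} {v}
      {gapCell Left k j} {rayDir a Left} (ray-gapCell-along a σ v Left k j)
      (subst (g ∈_) (sym (afterGap-values v Left k j lj)) mg)
  options-rayOption Right a σ v (gapCell Left k j) _ {g} mg = rayOption-map {a} {σ} {v} {gapCell Left k j}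
      {armDir a (armSign σ Left k)} (ray-gapCell-arm a σ v Left k j)
      (subst (g ∈_) (sym (armFrom-values v Left k j 0 armLength refl)) mg)
  options-rayOption Left a σ v (gapCell Right k j) _ {g} mg = rayOption-map {a} {σ} {v} {gapCell Right k j}
      {armDir a (armSign σ Right k)} (ray-gapCell-arm a σ v Right k j)
      (subst (g ∈_) (sym (armFrom-values v Right k j 0 armLength refl)) mg)
  options-rayOption Right a σ v (gapCell Right k j) (_ , lj) {g} mg = rayOption-map {a} {σ} {v}
      {gapCell Right k j} {rayDir a Right} (ray-gapCell-along a σ v Right k j)
      (subst (g ∈_) (sym (afterGap-values v Right k j lj)) mg)
  options-rayOption Left a σ v (armCell Left k j t) _ ()
  options-rayOption Right a σ v (armCell Left k j t) (_ , _ , lt) {g} mg = rayOption-map {a} {σ} {v}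
      {armCell Left k j t} {armDir a (armSign σ Left k)} (ray-armCell a σ v Left k j t)
      (subst (g ∈_) (sym (armFrom-values v Left k j (suc t) (m ∸ t) (arm-remaining lt))) mg)
  options-rayOption Left a σ v (armCell Right k j t) (_ , _ , lt) {g} mg = rayOption-map {a} {σ} {v}
      {armCell Right k j t} {armDir a (armSign σ Right k)} (ray-armCell a σ v Right k j t)
      (subst (g ∈_) (sym (armFrom-values v Right k j (suc t) (m ∸ t) (arm-remaining lt))) mg)
  options-rayOption Right a σ v (armCell Right k j t) _ ()
  options-rayOption Left a σ v (inChild Left k root) _ {g} mg with ∈-++⁻ (laterRay v Left k) mg
  ... | inj₁ m1 = rayOption-map {a} {σ} {v} {inChild Left k root} {rayDir a Left}
      (ray-childRoot-along a σ v Left k) (subst (g ∈_) (sym (afterChild-values v Left k)) m1)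
  ... | inj₂ m2 = rayOption-childRoot Left a σ v Left k Left g (ray-childRoot-Left a σ v Left k)
      (subst (g ∈_) (sym (rootRayˡ-values (child Left v k))) m2)
  options-rayOption Right a σ v (inChild Left k root) _ {g} mg = rayOption-childRoot Right a σ v Left k Right g
      (ray-childRoot-Right a σ v Left k) (subst (g ∈_) (sym (rootRayʳ-values (child Left v k))) mg)
  options-rayOption Left a σ v (inChild Right k root) _ {g} mg = rayOption-childRoot Left a σ v Right k Left g
      (ray-childRoot-Left a σ v Right k) (subst (g ∈_) (sym (rootRayˡ-values (child Right v k))) mg)
  options-rayOption Right a σ v (inChild Right k root) _ {g} mg with ∈-++⁻ (laterRay v Right k) mg
  ... | inj₁ m1 = rayOption-map {a} {σ} {v} {inChild Right k root} {rayDir a Right}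
      (ray-childRoot-along a σ v Right k) (subst (g ∈_) (sym (afterChild-values v Right k)) m1)
  ... | inj₂ m2 = rayOption-childRoot Right a σ v Right k Right g (ray-childRoot-Right a σ v Right k)
      (subst (g ∈_) (sym (rootRayʳ-values (child Right v k))) m2)
  options-rayOption p a σ v (inChild s k α@(gapCell _ _ _)) (_ , vα) {g} mg = rayOption-inChild p a σ v s k α g
      tt (options-rayOption p (not a) (σ xor odd k) (child s v k) α vα mg)
  options-rayOption p a σ v (inChild s k α@(armCell _ _ _ _)) (_ , vα) {g} mg = rayOption-inChild p a σ v s k α
      g tt (options-rayOption p (not a) (σ xor odd k) (child s v k) α vα mg)
  options-rayOption p a σ v (inChild s k α@(inChild _ _ _)) (_ , vα) {g} mg = rayOption-inChild p a σ v s k α g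
      tt (options-rayOption p (not a) (σ xor odd k) (child s v k) α vα mg)

  ∈-map-value : ∀ {v xs ys t} → map (value v) xs ≡ ys → t ∈ xs → value v t ∈ ys
  ∈-map-value {v} e mt = subst (_ ∈_) e (∈-map⁺ (value v) mt)

  rootRay-options : ∀ p a v d t → proj₁ (rootRay a v d) ≡ p → t ∈ proj₂ (rootRay a v d) → value v t ∈ options p (node v)
  rootRay-options p a v d t own mt with sameDir d (rayDir a Left)
  rootRay-options .Left a v d t refl mt | true = ∈-map-value (rootRayˡ-values v) mt
  ... | false with sameDir d (rayDir a Right)
  rootRay-options .Right a v d t refl mt | false | true = ∈-map-value (rootRayʳ-values v) mt
  rootRay-options p a v d t own () | false | false

  ray-options : ∀ p a σ v α d t → Valid v α → proj₁ (ray a σ v α d) ≡ p → t ∈ proj₂ (ray a σ v α d) → value v t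
      ∈ options p (value v α)
  ray-options p a σ v root d t _ own mt = rootRay-options p a v d t own mt
  ray-options p a σ v (gapCell s k j) d t (_ , lj) own mt with sameDir d (rayDir a s)
  ray-options .Left a σ v (gapCell Left k j) d t (_ , lj) refl mt | true = ∈-map-value
      (afterGap-values v Left k j lj) mt
  ray-options .Right a σ v (gapCell Right k j) d t (_ , lj) refl mt | true = ∈-map-value
      (afterGap-values v Right k j lj) mt
  ... | false with sameDir d (armDir a (armSign σ s k))
  ray-options .Right a σ v (gapCell Left k j) d t (_ , lj) refl mt | false | true = ∈-map-value
      (armFrom-values v Left k j 0 armLength refl) mt
  ray-options .Left a σ v (gapCell Right k j) d t (_ , lj) refl mt | false | true = ∈-map-value
      (armFrom-values v Right k j 0 armLength refl) mt
  ray-options p a σ v (gapCell s k j) d t (_ , lj) own () | false | false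
  ray-options p a σ v (armCell s k j t0) d t (_ , _ , lt) own mt with sameDir d (armDir a (armSign σ s k))
  ray-options .Right a σ v (armCell Left k j t0) d t (_ , _ , lt) refl mt | true = ∈-map-value
      (armFrom-values v Left k j (suc t0) (m ∸ t0) (arm-remaining lt)) mt
  ray-options .Left a σ v (armCell Right k j t0) d t (_ , _ , lt) refl mt | true = ∈-map-value
      (armFrom-values v Right k j (suc t0) (m ∸ t0) (arm-remaining lt)) mt
  ray-options p a σ v (armCell s k j t0) d t _ own () | false
  ray-options p a σ v (inChild s k root) d t (_ , _) own mt with sameDir d (rayDir a s)
  ray-options .Left a σ v (inChild Left k root) d t _ refl mt | true = ∈-++⁺ˡ
      (∈-map-value (afterChild-values v Left k) mt)
  ray-options .Right a σ v (inChild Right k root) d t _ refl mt | true = ∈-++⁺ˡ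
      (∈-map-value (afterChild-values v Right k) mt)
  ... | false with ∈-map⁻ (inChild s k) mt
  ... | t' , mt' , refl = subst (_∈ options p (value v (inChild s k root)))
      (sym (value-inChild v s k t' (rootRay-notRoot (not a) (child s v k) d mt')))
                            (inj s p (rootRay-options p (not a) (child s v k) d t' own mt'))
    where
    inj : ∀ s p {x} → x ∈ options p (node (child s v k)) → x ∈ options p (value v (inChild s k root))
    inj Left Left mx = ∈-++⁺ʳ (laterRay v Left k) mx
    inj Left Right mx = mx
    inj Right Left mx = mx
    inj Right Right mx = ∈-++⁺ʳ (laterRay v Right k) mx
  ray-options p a σ v (inChild s k α@(gapCell _ _ _)) d t (_ , vα) own mt with ∈-map⁻ (inChild s k) mt
  ... | t' , mt' , refl = subst (_∈ _) (sym (value-inChild v s k t'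
      (ray-notRoot (not a) (σ xor odd k) (child s v k) α d mt'))) (ray-options p (not a) (σ xor odd k)
      (child s v k) α d t' vα own mt')
  ray-options p a σ v (inChild s k α@(armCell _ _ _ _)) d t (_ , vα) own mt with ∈-map⁻ (inChild s k) mt
  ... | t' , mt' , refl = subst (_∈ _) (sym (value-inChild v s k t'
      (ray-notRoot (not a) (σ xor odd k) (child s v k) α d mt'))) (ray-options p (not a) (σ xor odd k)
      (child s v k) α d t' vα own mt')
  ray-options p a σ v (inChild s k α@(inChild _ _ _)) d t (_ , vα) own mt with ∈-map⁻ (inChild s k) mt
  ... | t' , mt' , refl = subst (_∈ _) (sym (value-inChild v s k t'
      (ray-notRoot (not a) (σ xor odd k) (child s v k) α d mt'))) (ray-options p (not a) (σ xor odd k)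
      (child s v k) α d t' vα own mt')


module LayoutRays (P0 : Game) where

  open Order
  open Layout P0
  open LayoutValues P0
  open ShiftLemmas
  open import Data.Nat as N using (zero; suc; _+_; _*_; _∸_; _≤_; _<_; s≤s; z≤n)
  open import Data.Nat.Properties as NP using (+-suc; +-comm)
  import Data.Integer.Properties as ZP
  open import Data.Integer as Z using (+_)
  open import Data.Bool using (Bool; true; false; if_then_else_; not; _xor_)
  open import Data.Product using (_×_; _,_; proj₁; proj₂)
  open import Data.List using (List; []; _∷_; map)
  open import Data.List.Membership.Propositional using (_∈_)
  open import Relation.Binary.PropositionalEquality using (_≡_; refl; sym; trans; cong; cong₂; subst)
  open import Data.Integer.Solver renaming (module +-*-Solver to ZS)
  open import Data.Unit using (tt)
  import Data.List.Relation.Unary.Any as Any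

  shift-one : ∀ x y d → shift (x , y) d 1 ≡ (x Z.+ δx d , y Z.+ δy d)
  shift-one x y d = cong₂ _,_ (cong (λ q → x Z.+ q) (ZP.*-identityˡ (δx d)))
      (cong (λ q → y Z.+ q) (ZP.*-identityˡ (δy d)))

  shift-rayDir : ∀ F s u w → shift (place F (u , w)) (rayDir (horizontal F) s) 1 ≡ place F
      (u , w Z.+ negateIf (isRight s) (+ 1))
  shift-rayDir (frame originX originY true σ) Left u w = trans (shift-one (originX Z.+ w) (originY Z.+ u) east)
      (cong₂ _,_ (ZP.+-assoc originX w _) (ZP.+-identityʳ _))
  shift-rayDir (frame originX originY true σ) Right u w = trans (shift-one (originX Z.+ w) (originY Z.+ u)
      west) (cong₂ _,_ (ZP.+-assoc originX w _) (ZP.+-identityʳ _))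
  shift-rayDir (frame originX originY false σ) Left u w = trans (shift-one (originX Z.+ u) (originY Z.+ w)
      north) (cong₂ _,_ (ZP.+-identityʳ _) (ZP.+-assoc originY w _))
  shift-rayDir (frame originX originY false σ) Right u w = trans (shift-one (originX Z.+ u) (originY Z.+ w)
      south) (cong₂ _,_ (ZP.+-identityʳ _) (ZP.+-assoc originY w _))

  shift-armDir : ∀ F b u w → shift (place F (u , w)) (armDir (horizontal F) b) 1 ≡ place F
      (u Z.+ negateIf b (+ 1) , w)
  shift-armDir (frame originX originY true σ) false u w = trans (shift-one (originX Z.+ w) (originY Z.+ u)
      north) (cong₂ _,_ (ZP.+-identityʳ _) (ZP.+-assoc originY u _))
  shift-armDir (frame originX originY true σ) true u w = trans (shift-one (originX Z.+ w) (originY Z.+ u)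
      south) (cong₂ _,_ (ZP.+-identityʳ _) (ZP.+-assoc originY u _))
  shift-armDir (frame originX originY false σ) false u w = trans (shift-one (originX Z.+ u) (originY Z.+ w)
      east) (cong₂ _,_ (ZP.+-assoc originX u _) (ZP.+-identityʳ _))
  shift-armDir (frame originX originY false σ) true u w = trans (shift-one (originX Z.+ u) (originY Z.+ w)
      west) (cong₂ _,_ (ZP.+-assoc originX u _) (ZP.+-identityʳ _))

  negateIf-suc : ∀ b n → negateIf b (+ suc n) Z.+ negateIf b (+ 1) ≡ negateIf b (+ suc (suc n))
  negateIf-suc false n = cong +_ (cong suc (+-comm n 1))
  negateIf-suc true n = trans (sym (ZP.neg-distrib-+ (+ suc n) (+ 1)))
      (cong Z.-_ (cong +_ (cong suc (+-comm n 1))))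

  rayCoord-suc : ∀ s i → rayCoord s i Z.+ negateIf (isRight s) (+ 1) ≡ rayCoord s (suc i)
  rayCoord-suc s i = negateIf-suc (isRight s) i

  enc-childRoot : ∀ F v s k → enc F v (inChild s k root) ≡ place F (+ 0 , rayCoord s (k * period v + gap v))
  enc-childRoot (frame originX originY true σ) v s k = cong₂ _,_ (ZP.+-identityʳ _) (ZP.+-identityʳ _)
  enc-childRoot (frame originX originY false σ) v s k = cong₂ _,_ (ZP.+-identityʳ _) (ZP.+-identityʳ _)

  sameDir-sound : ∀ d d' → sameDir d d' ≡ true → d ≡ d'
  sameDir-sound north north _ = refl
  sameDir-sound south south _ = refl
  sameDir-sound east east _ = refl
  sameDir-sound west west _ = refl
  sameDir-sound north south ()
  sameDir-sound north east ()
  sameDir-sound north west ()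
  sameDir-sound south north ()
  sameDir-sound south east ()
  sameDir-sound south west ()
  sameDir-sound east north ()
  sameDir-sound east south ()
  sameDir-sound east west ()
  sameDir-sound west north ()
  sameDir-sound west south ()
  sameDir-sound west east ()


  RayStep : Frame → Game → Address → Dir → Player → Address → List Address → Set
  RayStep F v α d p t ts = Valid v t × (enc F v t ≡ shift (enc F v α) d 1) ×
      (ray (horizontal F) (parity F) v t d ≡ (p , ts))

  ∸-suc-suc : ∀ n k c → n ∸ suc k ≡ suc c → n ∸ suc (suc k) ≡ c
  ∸-suc-suc n k c e = proj₂ (∸≡suc⇒ n (suc k) c e)

  segments-first : ∀ a σ v s k c {t ts} → nChildren s v ∸ k ≡ suc c → segments v s k (suc c) ≡ t ∷ ts →
    (t ≡ gapCell s k 0) × Valid v t × (ray a σ v t (rayDir a s) ≡ (s , ts))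
  segments-first a σ v s k c e refl = refl , (proj₁ (∸≡suc⇒ (nChildren s v) k c e) , s≤s z≤n) ,
    trans (ray-gapCell-along a σ v s k 0) (cong (λ q → (s , gapCells s k 1 (gap v ∸ 1)
        (inChild s k root ∷ segments v s (suc k) q))) (proj₂ (∸≡suc⇒ (nChildren s v) k c e)))

  ∸≡suc⇒< : ∀ g j x → g ∸ suc j ≡ suc x → suc j < g
  ∸≡suc⇒< (suc (suc g)) zero x e = s≤s (s≤s z≤n)
  ∸≡suc⇒< (suc zero) zero x ()
  ∸≡suc⇒< (suc g) (suc j) x e = s≤s (∸≡suc⇒< g j x e)
  ∸≡suc⇒< zero j x ()

  ∸≡0⇒suc≡ : ∀ g j → j < g → g ∸ suc j ≡ 0 → suc j ≡ g
  ∸≡0⇒suc≡ (suc zero) zero _ _ = refl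
  ∸≡0⇒suc≡ (suc (suc g)) zero _ ()
  ∸≡0⇒suc≡ (suc g) (suc j) (s≤s l) e = cong suc (∸≡0⇒suc≡ g j l e)

  period-suc : ∀ v k j → k * period v + suc j ≡ suc (k * period v + j)
  period-suc v k j = +-suc (k * period v) j

  rayCoord-zero : ∀ s → + 0 Z.+ negateIf (isRight s) (+ 1) ≡ rayCoord s 0
  rayCoord-zero Left = refl
  rayCoord-zero Right = refl

  rayStep-root : ∀ F v s p t ts c → nChildren s v ≡ c → s ≡ p → segments v s 0 c ≡ t ∷ ts → RayStep F v root
      (rayDir (horizontal F) s) p t ts
  rayStep-root F v s p t ts zero en ep ()
  rayStep-root F v s .s t ts (suc c) en refl es with segments-first (horizontal F) (parity F) v s 0 c en es
  ... | refl , vt , rt = vt , sym (trans (shift-rayDir F s (+ 0) (+ 0))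
      (cong (λ q → place F (+ 0 , q)) (rayCoord-zero s))) , rt

  rayStep-gapCell-along : ∀ F v s k j t ts x → k < nChildren s v → j < gap v → gap v ∸ suc j ≡ x →
    gapCells s k (suc j) x (inChild s k root ∷ afterChild v s k) ≡ t ∷ ts → RayStep F v (gapCell s k j)
        (rayDir (horizontal F) s) s t ts
  rayStep-gapCell-along F v s k j t ts zero lk lj ex refl = (lk , tt) ,
    trans (enc-childRoot F v s k) (sym (trans (shift-rayDir F s (+ 0) (rayCoord s (k * period v + j)))
        (cong (λ q → place F (+ 0 , q)) (trans (rayCoord-suc s (k * period v + j))
        (cong (rayCoord s) (trans (sym (period-suc v k j)) (cong (λ q → k * period v + q)
        (∸≡0⇒suc≡ (gap v) j lj ex)))))))) ,
    ray-childRoot-along (horizontal F) (parity F) v s k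
  rayStep-gapCell-along F v s k j t ts (suc x) lk lj ex refl = (lk , ∸≡suc⇒< (gap v) j x ex) ,
    sym (trans (shift-rayDir F s (+ 0) (rayCoord s (k * period v + j)))
        (cong (λ q → place F (+ 0 , q)) (trans (rayCoord-suc s (k * period v + j))
        (cong (rayCoord s) (sym (period-suc v k j)))))) ,
    trans (ray-gapCell-along (horizontal F) (parity F) v s k (suc j))
        (cong (λ q → (s , gapCells s k (suc (suc j)) q (inChild s k root ∷ afterChild v s k)))
        (∸-suc-suc (gap v) j x ex))

  rayStep-gapCell-arm : ∀ F v s k j t ts → k < nChildren s v → j < gap v → armFrom s k j 0 armLength ≡ t ∷ ts →
    RayStep F v (gapCell s k j) (armDir (horizontal F) (armSign (parity F) s k)) (opponent s) t ts
  rayStep-gapCell-arm F v s k j t ts lk lj refl = (lk , lj , s≤s z≤n) ,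
    sym (trans (shift-armDir F (armSign (parity F) s k) (+ 0) (rayCoord s (k * period v + j)))
        (cong (λ q → place F (q , rayCoord s (k * period v + j))) (ZP.+-identityˡ _))) ,
    ray-armCell (horizontal F) (parity F) v s k j 0

  rayStep-armCell : ∀ F v s k j t0 t ts x → k < nChildren s v → j < gap v → m ∸ t0 ≡ x → armFrom s k j (suc t0)
      x ≡ t ∷ ts →
    RayStep F v (armCell s k j t0) (armDir (horizontal F) (armSign (parity F) s k)) (opponent s) t ts
  rayStep-armCell F v s k j t0 t ts zero lk lj ex ()
  rayStep-armCell F v s k j t0 t ts (suc x) lk lj ex refl = (lk , lj , s≤s (proj₁ (∸≡suc⇒ m t0 x ex))) ,
    sym (trans (shift-armDir F (armSign (parity F) s k) (negateIf (armSign (parity F) s k) (+ suc t0))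
        (rayCoord s (k * period v + j))) (cong (λ q → place F (q , rayCoord s (k * period v + j)))
        (negateIf-suc (armSign (parity F) s k) t0))) ,
    trans (ray-armCell (horizontal F) (parity F) v s k j (suc t0)) (cong
        (λ q → (opponent s , armFrom s k j (suc (suc t0)) q)) (proj₂ (∸≡suc⇒ m t0 x ex)))

  period-next : ∀ v k → suc k * period v + 0 ≡ suc (k * period v + gap v)
  period-next v k = trans (NP.+-identityʳ (suc k * period v)) (cong suc (+-comm (gap v) (k * period v)))

  rayStep-childRoot-along : ∀ F v s k t ts c → nChildren s v ∸ suc k ≡ c → segments v s (suc k) c ≡ t ∷ ts →
      RayStep F v (inChild s k root) (rayDir (horizontal F) s) s t ts
  rayStep-childRoot-along F v s k t ts zero ex ()
  rayStep-childRoot-along F v s k t ts (suc c) ex es with segments-first (horizontal F) (parity F) v s (suc k) c ex es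
  ... | refl , vt , rt = vt ,
    sym (trans (cong (λ q → shift q (rayDir (horizontal F) s) 1) (enc-childRoot F v s k))
        (trans (shift-rayDir F s (+ 0) (rayCoord s (k * period v + gap v)))
        (cong (λ q → place F (+ 0 , q)) (trans (rayCoord-suc s (k * period v + gap v))
        (cong (rayCoord s) (sym (period-next v k))))))) , rt

  rayStep-inChild : ∀ F v s k α d p t' ts' → k < nChildren s v → NotRoot t' →
    RayStep (childFrame F v s k) (child s v k) α d p t' ts' →
    RayStep F v (inChild s k α) d p (inChild s k t') (map (inChild s k) ts')
  rayStep-inChild F v s k α d p t' ts' lk nh (vt , et , rt) = (lk , vt) , et ,
    trans (ray-inChild (horizontal F) (parity F) v s k t' d nh) (cong (inChildRay s k) rt)

  ray-step : ∀ F v α d p t ts → Valid v α → ray (horizontal F) (parity F) v α d ≡ (p , t ∷ ts) → RayStep F v α d p t ts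
  ray-step F v root d p t ts _ e with sameDir d (rayDir (horizontal F) Left) in e1
  ... | true with sameDir-sound d _ e1
  ... | refl = rayStep-root F v Left p t ts (nChildren Left v) refl (cong proj₁ e) (cong proj₂ e)
  ray-step F v root d p t ts _ e | false with sameDir d (rayDir (horizontal F) Right) in e2
  ... | true with sameDir-sound d _ e2
  ... | refl = rayStep-root F v Right p t ts (nChildren Right v) refl (cong proj₁ e) (cong proj₂ e)
  ray-step F v root d p t ts _ () | false | false
  ray-step F v (gapCell s k j) d p t ts (lk , lj) e with sameDir d (rayDir (horizontal F) s) in e1
  ... | true with sameDir-sound d _ e1 | cong proj₁ e
  ... | refl | refl = rayStep-gapCell-along F v s k j t ts (gap v ∸ suc j) lk lj refl (cong proj₂ e)
  ray-step F v (gapCell s k j) d p t ts (lk , lj) e | false with sameDir d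
      (armDir (horizontal F) (armSign (parity F) s k)) in e2
  ... | true with sameDir-sound d _ e2 | cong proj₁ e
  ... | refl | refl = rayStep-gapCell-arm F v s k j t ts lk lj (cong proj₂ e)
  ray-step F v (gapCell s k j) d p t ts (lk , lj) () | false | false
  ray-step F v (armCell s k j t0) d p t ts (lk , lj , _) e with sameDir d
      (armDir (horizontal F) (armSign (parity F) s k)) in e1
  ... | true with sameDir-sound d _ e1 | cong proj₁ e
  ... | refl | refl = rayStep-armCell F v s k j t0 t ts (m ∸ t0) lk lj refl (cong proj₂ e)
  ray-step F v (armCell s k j t0) d p t ts _ () | false
  ray-step F v (inChild s k root) d p t ts (lk , _) e with sameDir d (rayDir (horizontal F) s) in e1
  ... | true with sameDir-sound d _ e1 | cong proj₁ e
  ... | refl | refl = rayStep-childRoot-along F v s k t ts (nChildren s v ∸ suc k) refl (cong proj₂ e)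
  ray-step F v (inChild s k root) d p t ts (lk , _) e | false with rootRay (not (horizontal F)) (child s v k) d in er
  ... | (p' , []) with e
  ... | ()
  ray-step F v (inChild s k root) d p t ts (lk , _) e | false | (p' , t' ∷ ts') with e
  ... | refl = rayStep-inChild F v s k root d p' t' ts' lk (rootRay-notRoot (not (horizontal F)) (child s v k)
      d (subst (λ q → t' ∈ proj₂ q) (sym er) (Any.here refl)))
                 (ray-step (childFrame F v s k) (child s v k) root d p' t' ts' tt er)
  ray-step F v (inChild s k α@(gapCell _ _ _)) d p t ts (lk , vα) e with ray (not (horizontal F))
      (parity F xor odd k) (child s v k) α d in er
  ... | (p' , []) with e
  ... | ()
  ray-step F v (inChild s k α@(gapCell _ _ _)) d p t ts (lk , vα) e | (p' , t' ∷ ts') with e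
  ... | refl = rayStep-inChild F v s k α d p' t' ts' lk (ray-notRoot (not (horizontal F)) (parity F xor odd k)
      (child s v k) α d (subst (λ q → t' ∈ proj₂ q) (sym er) (Any.here refl)))
                 (ray-step (childFrame F v s k) (child s v k) α d p' t' ts' vα er)
  ray-step F v (inChild s k α@(armCell _ _ _ _)) d p t ts (lk , vα) e with ray (not (horizontal F))
      (parity F xor odd k) (child s v k) α d in er
  ... | (p' , []) with e
  ... | ()
  ray-step F v (inChild s k α@(armCell _ _ _ _)) d p t ts (lk , vα) e | (p' , t' ∷ ts') with e
  ... | refl = rayStep-inChild F v s k α d p' t' ts' lk (ray-notRoot (not (horizontal F)) (parity F xor odd k)
      (child s v k) α d (subst (λ q → t' ∈ proj₂ q) (sym er) (Any.here refl)))
                 (ray-step (childFrame F v s k) (child s v k) α d p' t' ts' vα er)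
  ray-step F v (inChild s k α@(inChild _ _ _)) d p t ts (lk , vα) e with ray (not (horizontal F))
      (parity F xor odd k) (child s v k) α d in er
  ... | (p' , []) with e
  ... | ()
  ray-step F v (inChild s k α@(inChild _ _ _)) d p t ts (lk , vα) e | (p' , t' ∷ ts') with e
  ... | refl = rayStep-inChild F v s k α d p' t' ts' lk (ray-notRoot (not (horizontal F)) (parity F xor odd k)
      (child s v k) α d (subst (λ q → t' ∈ proj₂ q) (sym er) (Any.here refl)))
                 (ray-step (childFrame F v s k) (child s v k) α d p' t' ts' vα er)


module LayoutBounds (P0 : Game) where

  open Order
  open Layout P0
  open IntegerLemmas hiding (negateIf)
  open import Data.Nat as N using (ℕ; zero; suc; _+_; _*_; _⊔_; _≤_; _<_; s≤s; z≤n)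
  import Data.Nat.Properties as NP
  open import Data.Integer as Z using (ℤ; +_; ∣_∣)
  import Data.Integer.Properties as ZP
  open import Data.Bool using (Bool; true; false; not; _xor_)
  open import Data.Product using (_×_; _,_)
  open import Data.Empty using (⊥-elim)
  open import Data.List using (List; _∷_; length)
  open import Data.List.Relation.Unary.Any as Any using (Any)
  open import Data.List.Membership.Propositional using (_∈_)
  open import Relation.Binary.PropositionalEquality using (_≡_; _≢_; refl; sym; trans; cong; subst)

  maxChildren : Game → ℕ
  maxChildren ⟨ L ∣ R ⟩ = length L ⊔ length R

  radius-unfold : ∀ v → radius v ≡ maxChildren v * period v + childRadius v + armLength
  radius-unfold ⟨ L ∣ R ⟩ = refl

  radius≤maxRadius : ∀ {c cs} → c ∈ cs → radius c ≤ maxRadius cs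
  radius≤maxRadius {cs = c ∷ cs} (Any.here refl) = NP.m≤m⊔n (radius c) (maxRadius cs)
  radius≤maxRadius {cs = c' ∷ cs} (Any.there m) = NP.≤-trans (radius≤maxRadius m)
      (NP.m≤n⊔m (radius c') (maxRadius cs))

  radius-child : ∀ s v k → k < nChildren s v → radius (child s v k) ≤ childRadius v
  radius-child Left ⟨ L ∣ R ⟩ k l = NP.≤-trans (radius≤maxRadius (nth-∈ L k l))
      (NP.m≤m⊔n (maxRadius L) (maxRadius R))
  radius-child Right ⟨ L ∣ R ⟩ k l = NP.≤-trans (radius≤maxRadius (nth-∈ R k l))
      (NP.m≤n⊔m (maxRadius L) (maxRadius R))

  nChildren≤maxChildren : ∀ s v → nChildren s v ≤ maxChildren v
  nChildren≤maxChildren Left ⟨ L ∣ R ⟩ = NP.m≤m⊔n (length L) (length R)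
  nChildren≤maxChildren Right ⟨ L ∣ R ⟩ = NP.m≤n⊔m (length L) (length R)

  position<bound : ∀ k j n period → k < n → j < period → suc (k * period + j) ≤ n * period
  position<bound k j n (suc S') lk (s≤s lj) = NP.≤-trans (NP.≤-trans (s≤s (NP.+-monoʳ-≤ (k * suc S') lj))
      (NP.≤-reflexive (trans (sym (NP.+-suc (k * suc S') S')) (NP.+-comm (k * suc S') (suc S')))))
    (NP.*-monoˡ-≤ (suc S') lk)

  rayCoord≤radius : ∀ s v k j → k < nChildren s v → j < period v → suc (k * period v + j) ≤ radius v
  rayCoord≤radius s v k j lk lj = NP.≤-trans (position<bound k j (maxChildren v) (period v)
      (NP.<-≤-trans lk (nChildren≤maxChildren s v)) lj)
    (NP.≤-trans (NP.≤-trans (NP.m≤m+n (maxChildren v * period v) (childRadius v)) (NP.m≤m+n _ armLength))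
        (NP.≤-reflexive (sym (radius-unfold v))))

  armLength≤radius : ∀ v → armLength ≤ radius v
  armLength≤radius v = NP.≤-trans (NP.m≤n+m armLength _) (NP.≤-reflexive (sym (radius-unfold v)))

  childRadius≤radius : ∀ v → childRadius v ≤ radius v
  childRadius≤radius v = NP.≤-trans (NP.≤-trans (NP.m≤n+m (childRadius v) (maxChildren v * period v))
      (NP.m≤m+n _ armLength)) (NP.≤-reflexive (sym (radius-unfold v)))

  -- The node is the only cell of its layout on the line w = 0, and the cells off that line with
  -- |w| ≤ armLength (the arms of the first segments) lie in the two quadrants selected by σ.
  InRegion : Bool → Game → ℤ × ℤ → Set
  InRegion σ v (u , w) = (∣ u ∣ ≤ radius v) × (∣ w ∣ ≤ radius v) × (w ≡ + 0 → u ≡ + 0) ×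
                    (u ≢ + 0 → 1 ≤ ∣ w ∣ → ∣ w ∣ ≤ armLength → isNegative u ≡ not (σ xor isNegative w))

  ∣shifted∣-bound : ∀ b X u R → ∣ u ∣ ≤ R → X ≤ ∣ negateIf b (+ X) Z.+ u ∣ + R
  ∣shifted∣-bound b X u R l = subst (λ q → X ≤ q + R) (sym e) (∣D+x∣-lower X (negateIf b u) R
      (subst (_≤ R) (sym (∣negateIf∣ b u)) l))
    where
    e : ∣ negateIf b (+ X) Z.+ u ∣ ≡ ∣ + X Z.+ negateIf b u ∣
    e = trans (cong ∣_∣ (trans (cong (λ q → negateIf b (+ X) Z.+ q) (sym (negateIf-involutive b u)))
        (sym (negateIf-+ b (+ X) (negateIf b u))))) (∣negateIf∣ b _)

  childRadius+armLength<period : ∀ v → childRadius v + armLength < period v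
  childRadius+armLength<period v = s≤s (NP.≤-trans (NP.+-monoˡ-≤ armLength
      (NP.m≤m+n (childRadius v) (childRadius v))) (NP.n≤1+n _))

  period≤childPosition : ∀ v k → period v ≤ suc (k * period v + gap v)
  period≤childPosition v k = s≤s (NP.m≤n+m (gap v) (k * period v))

  armLength<∣childCoord∣ : ∀ v s k u → ∣ u ∣ ≤ childRadius v → armLength < ∣ rayCoord s (k * period v + gap v) Z.+ u ∣
  armLength<∣childCoord∣ v s k u l = NP.≰⇒> λ le → NP.<-irrefl refl
      (NP.<-≤-trans (childRadius+armLength<period v) (NP.≤-trans (period≤childPosition v k)
      (NP.≤-trans (∣shifted∣-bound (isRight s) _ u (childRadius v) l)
      (NP.≤-trans (NP.+-monoˡ-≤ (childRadius v) le) (NP.≤-reflexive (NP.+-comm armLength (childRadius v)))))))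

  childCoord≢0 : ∀ v s k u → ∣ u ∣ ≤ childRadius v → rayCoord s (k * period v + gap v) Z.+ u ≢ + 0
  childCoord≢0 v s k u l e = NP.<-irrefl refl (NP.<-≤-trans (armLength<∣childCoord∣ v s k u l)
      (NP.≤-trans (NP.≤-reflexive (cong ∣_∣ e)) z≤n))

  ∣childCoord∣≤radius : ∀ v s k u → k < nChildren s v → ∣ u ∣ ≤ childRadius v → ∣ rayCoord s
      (k * period v + gap v) Z.+ u ∣ ≤ radius v
  ∣childCoord∣≤radius v s k u lk l = NP.≤-trans (ZP.∣i+j∣≤∣i∣+∣j∣ (rayCoord s (k * period v + gap v)) u)
      (NP.≤-trans (NP.+-mono-≤ (NP.≤-reflexive (∣negateIf∣ (isRight s) (+ suc (k * period v + gap v)))) l)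
      (NP.≤-trans (NP.+-monoˡ-≤ (childRadius v) (position<bound k (gap v) (maxChildren v) (period v)
      (NP.<-≤-trans lk (nChildren≤maxChildren s v)) NP.≤-refl)) (NP.≤-trans (NP.m≤m+n _ armLength)
      (NP.≤-reflexive (sym (radius-unfold v))))))

  loc-inRegion : ∀ σ v α → Valid v α → InRegion σ v (loc σ v α)
  loc-inRegion σ v root _ = z≤n , z≤n , (λ _ → refl) , (λ nz → ⊥-elim (nz refl))
  loc-inRegion σ v (gapCell s k j) (lk , lj) = z≤n , subst (_≤ radius v) (sym (∣negateIf∣ (isRight s) _))
      (rayCoord≤radius s v k j lk (NP.≤-trans lj (NP.n≤1+n _))) ,
    (λ e → ⊥-elim (negateIf-suc≢0 (isRight s) _ e)) , (λ nz → ⊥-elim (nz refl))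
  loc-inRegion σ v (armCell s k j t) (lk , lj , lt) = subst (_≤ radius v)
      (sym (∣negateIf∣ (armSign σ s k) (+ suc t))) (NP.≤-trans lt (armLength≤radius v)) ,
    subst (_≤ radius v) (sym (∣negateIf∣ (isRight s) _)) (rayCoord≤radius s v k j lk
        (NP.≤-trans lj (NP.n≤1+n _))) ,
    (λ e → ⊥-elim (negateIf-suc≢0 (isRight s) _ e)) , armSide
    where
    armSide : negateIf (armSign σ s k) (+ suc t) ≢ + 0 → 1 ≤ ∣ rayCoord s (k * period v + j) ∣ → ∣ rayCoord s
        (k * period v + j) ∣ ≤ armLength →
         isNegative (negateIf (armSign σ s k) (+ suc t)) ≡ not (σ xor isNegative
             (rayCoord s (k * period v + j)))
    armSide _ _ le = armSide-segment k le
      where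
      armSide-segment : ∀ k → ∣ rayCoord s (k * period v + j) ∣ ≤ armLength → isNegative
          (negateIf (armSign σ s k) (+ suc t)) ≡ not (σ xor isNegative (rayCoord s (k * period v + j)))
      armSide-segment zero le = trans (isNegative-negateIf-suc _ t)
          (cong (λ q → not (σ xor q)) (trans (xor-identityʳ (isRight s))
          (sym (isNegative-negateIf-suc (isRight s) j))))
      armSide-segment (suc k') le = ⊥-elim (NP.<-irrefl refl (NP.<-≤-trans (childRadius+armLength<period v)
          (NP.≤-trans (NP.≤-trans (NP.m≤m+n (period v) (k' * period v))
          (NP.≤-trans (NP.m≤m+n _ j) (NP.n≤1+n _))) (NP.≤-trans (NP.≤-reflexive
          (sym (∣negateIf∣ (isRight s) (+ suc (suc k' * period v + j)))))
          (NP.≤-trans le (NP.m≤n+m armLength (childRadius v)))))))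
  loc-inRegion σ v (inChild s k γ) (lk , vγ) with loc-inRegion (σ xor odd k) (child s v k) γ vγ
  ... | bu , bw , _ , _ = NP.≤-trans bw (NP.≤-trans (radius-child s v k lk) (childRadius≤radius v)) ,
    ∣childCoord∣≤radius v s k _ lk (NP.≤-trans bu (radius-child s v k lk)) ,
    (λ e → ⊥-elim (childCoord≢0 v s k _ (NP.≤-trans bu (radius-child s v k lk)) e)) ,
    (λ _ _ le → ⊥-elim (NP.<-irrefl refl (NP.<-≤-trans (armLength<∣childCoord∣ v s k _
        (NP.≤-trans bu (radius-child s v k lk))) le)))


module LayoutInjective (P0 : Game) where

  open Order
  open Layout P0
  open IntegerLemmas hiding (negateIf)
  open NatLemmas
  open LayoutBounds P0
  open import Data.Nat as N using (ℕ; suc; _+_; _*_; _≤_; _<_; s≤s; z≤n)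
  import Data.Nat.Properties as NP
  open import Data.Integer as Z using (ℤ; +_; ∣_∣)
  import Data.Integer.Properties as ZP
  open import Algebra.Properties.AbelianGroup ZP.+-0-abelianGroup using (∙-cancelˡ)
  open import Data.Bool using (Bool; true; false; not; _xor_)
  open import Data.Product using (_×_; _,_; ∃; proj₁; proj₂)
  open import Data.Sum using (_⊎_; inj₁; inj₂)
  open import Data.Empty using (⊥; ⊥-elim)
  open import Relation.Binary.PropositionalEquality using (_≡_; _≢_; refl; sym; trans; cong; cong₂; subst)

  childPosition : Game → ℕ → ℕ
  childPosition v k = suc (k * period v + gap v)

  childRadius<childPosition : ∀ v k → childRadius v < childPosition v k
  childRadius<childPosition v k = NP.<-≤-trans (NP.≤-trans (s≤s (NP.m≤m+n (childRadius v) armLength))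
      (childRadius+armLength<period v)) (period≤childPosition v k)

  childCoord-sign : ∀ v s k u → ∣ u ∣ ≤ childRadius v → isNegative (rayCoord s (k * period v + gap v) Z.+ u) ≡ isRight s
  childCoord-sign v s k u l = isNegative-negateIf-large (isRight s) (childPosition v k) u
      (NP.≤-<-trans l (childRadius<childPosition v k))

  isRight-injective : ∀ s s' → isRight s ≡ isRight s' → s ≡ s'
  isRight-injective Left Left _ = refl
  isRight-injective Right Right _ = refl
  isRight-injective Left Right ()
  isRight-injective Right Left ()

  childCoord-normalise : ∀ v s k u → negateIf (isRight s) (rayCoord s (k * period v + gap v) Z.+ u) ≡ +
      childPosition v k Z.+ negateIf (isRight s) u
  childCoord-normalise v s k u = trans (negateIf-+ (isRight s) _ u)
      (cong (Z._+ negateIf (isRight s) u) (negateIf-involutive (isRight s) (+ childPosition v k)))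

  2childRadius<period : ∀ v → childRadius v + childRadius v < period v
  2childRadius<period v = s≤s (NP.≤-trans (NP.m≤m+n (childRadius v + childRadius v) armLength) (NP.n≤1+n _))

  gap<period : ∀ v → gap v < period v
  gap<period v = NP.≤-refl

  childLoc-bound : ∀ σ v s k γ → k < nChildren s v → Valid (child s v k) γ → ∣ proj₁
      (loc (σ xor odd k) (child s v k) γ) ∣ ≤ childRadius v
  childLoc-bound σ v s k γ lk vγ = NP.≤-trans (proj₁ (loc-inRegion (σ xor odd k) (child s v k) γ vγ))
      (radius-child s v k lk)


  ArmCoord : Bool → Player → ℕ → ℤ → Set
  ArmCoord σ s k uα = (uα ≡ + 0) ⊎ (∃ λ t → (t < armLength) × (uα ≡ negateIf (armSign σ s k) (+ suc t)))

  -- Only children k and k - 1 come near segment k, and near the ray their cells lie on the side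
  -- opposite to the arms, by the sign condition of InRegion.
  gapCell≢childCell : ∀ σ v s k j s' k' γ → k < nChildren s v → j < gap v → k' < nChildren s' v → Valid
      (child s' v k') γ →
    ∀ uα → ArmCoord σ s k uα → (uα , rayCoord s (k * period v + j)) ≡ loc σ v (inChild s' k' γ) → ⊥
  gapCell≢childCell σ v s k j s' k' γ lk lj lk' vγ uα cls e
    with isRight-injective s s' (trans (sym (isNegative-negateIf-suc (isRight s) (k * period v + j)))
        (trans (cong (λ q → isNegative (proj₂ q)) e) (childCoord-sign v s' k' _
        (childLoc-bound σ v s' k' γ lk' vγ))))
  ... | refl = byArmCoord cls
    where
    σ' = σ xor odd k'
    c = child s v k'
    l = loc σ' c γ
    ns = isRight s
    uBound : ∣ proj₁ l ∣ ≤ childRadius v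
    uBound = childLoc-bound σ v s k' γ lk' vγ
    ũ = negateIf ns (proj₁ l)
    ũBound : ∣ ũ ∣ ≤ childRadius v
    ũBound = subst (_≤ childRadius v) (sym (∣negateIf∣ ns (proj₁ l))) uBound
    positions : + suc (k * period v + j) ≡ + childPosition v k' Z.+ ũ
    positions = trans (sym (negateIf-involutive ns (+ suc (k * period v + j))))
        (trans (cong (λ q → negateIf ns (proj₂ q)) e) (childCoord-normalise v s k' (proj₁ l)))
    closeness = close-naturals (suc (k * period v + j)) (childPosition v k') ũ (childRadius v) positions ũBound
    notAtChild : suc (k * period v + j) ≡ childPosition v k' → ⊥
    notAtChild e' = NP.<-irrefl (proj₂ (division-unique (period v) k j k' (gap v)
        (NP.<-trans lj (gap<period v)) (gap<period v) (NP.suc-injective e'))) lj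
    reg = loc-inRegion σ' c γ vγ
    u≢0 : proj₁ l ≢ + 0
    u≢0 z = notAtChild (ZP.+-injective (trans positions (trans (cong (λ q → + childPosition v k' Z.+ q)
        (trans (cong (negateIf ns) z) (negateIf-zero ns))) (ZP.+-identityʳ _))))
    byArmCoord : ArmCoord σ s k uα → ⊥
    byArmCoord (inj₁ z) = u≢0 (proj₁ (proj₂ (proj₂ reg)) (trans (sym (cong proj₁ e)) z))
    byArmCoord (inj₂ (t , lt , ea)) = impossible (near-childPosition (period v) (gap v) (childRadius v) k j k'
        lj (gap<period v) (NP.≤-<-trans (NP.m≤m+n (childRadius v) armLength) (childRadius+armLength<period v))
        (proj₁ closeness) (proj₁ (proj₂ closeness)))
      where
      w≡arm : proj₂ l ≡ negateIf (armSign σ s k) (+ suc t)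
      w≡arm = trans (sym (cong proj₁ e)) ea
      armSide : isNegative (proj₁ l) ≡ not (σ' xor armSign σ s k)
      armSide = trans (proj₂ (proj₂ (proj₂ reg)) u≢0 (subst (λ q → 1 ≤ ∣ q ∣) (sym w≡arm)
          (subst (1 ≤_) (sym (∣negateIf-suc∣ (armSign σ s k) t)) (s≤s z≤n)))
          (subst (λ q → ∣ q ∣ ≤ armLength) (sym w≡arm) (subst (_≤ armLength)
          (sym (∣negateIf-suc∣ (armSign σ s k) t)) lt)))
                 (cong (λ q → not (σ' xor q)) (trans (cong isNegative w≡arm) (isNegative-negateIf-suc _ t)))
      ũ≢0 : ũ ≢ + 0
      ũ≢0 z = u≢0 (negateIf≡0 ns (proj₁ l) z)
      signOfU : isNegative (proj₁ l) ≡ ns xor isNegative ũ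
      signOfU = trans (cong isNegative (sym (negateIf-involutive ns (proj₁ l)))) (isNegative-negateIf ns ũ ũ≢0)
      impossible : (k ≡ k' × suc (k * period v + j) < childPosition v k') ⊎
          (k ≡ suc k' × childPosition v k' < suc (k * period v + j)) → ⊥
      impossible (inj₁ (refl , lt')) = armSide-before σ ns (odd k) (trans
          (sym (cong (ns xor_) (isNegative-of-< _ _ ũ positions lt'))) (trans (sym signOfU) armSide))
      impossible (inj₂ (refl , lt')) = armSide-after σ ns (odd k') (trans
          (sym (cong (ns xor_) (nonNegative-of-> _ _ ũ positions lt'))) (trans (sym signOfU) armSide))

  sameChild : ∀ σ v s k γ s' k' γ' → k < nChildren s v → Valid (child s v k) γ → k' < nChildren s' v → Valid
      (child s' v k') γ' →
    loc σ v (inChild s k γ) ≡ loc σ v (inChild s' k' γ') → (s ≡ s') × (k ≡ k')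
  sameChild σ v s k γ s' k' γ' lk vγ lk' vγ' e
    with isRight-injective s s' (trans (sym (childCoord-sign v s k _ (childLoc-bound σ v s k γ lk vγ)))
        (trans (cong (λ q → isNegative (proj₂ q)) e) (childCoord-sign v s' k' _
        (childLoc-bound σ v s' k' γ' lk' vγ'))))
  ... | refl = refl , k≡k'
    where
    ns = isRight s
    l = loc (σ xor odd k) (child s v k) γ
    l' = loc (σ xor odd k') (child s v k') γ'
    ũ = negateIf ns (proj₁ l)
    ũ' = negateIf ns (proj₁ l')
    E : + childPosition v k Z.+ ũ ≡ + childPosition v k' Z.+ ũ'
    E = trans (sym (childCoord-normalise v s k (proj₁ l))) (trans (cong (λ q → negateIf ns (proj₂ q)) e)
        (childCoord-normalise v s k' (proj₁ l')))
    ũBound : ∣ ũ ∣ ≤ childRadius v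
    ũBound = subst (_≤ childRadius v) (sym (∣negateIf∣ ns (proj₁ l))) (childLoc-bound σ v s k γ lk vγ)
    ũ'Bound : ∣ ũ' ∣ ≤ childRadius v
    ũ'Bound = subst (_≤ childRadius v) (sym (∣negateIf∣ ns (proj₁ l'))) (childLoc-bound σ v s k' γ' lk' vγ')
    closeness = close-naturals (childPosition v k) (childPosition v k') (ũ' Z.- ũ)
        (childRadius v + childRadius v) (+-rearrange (+ childPosition v k) ũ (+ childPosition v k') ũ' E)
           (NP.≤-trans (ZP.∣i-j∣≤∣i∣+∣j∣ ũ' ũ) (NP.+-mono-≤ ũ'Bound ũBound))
    k≡k' : k ≡ k'
    k≡k' = near-childPositions-equal (period v) (gap v) (childRadius v) k k' (2childRadius<period v)
        (proj₁ closeness) (proj₁ (proj₂ closeness))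

  childLoc-injective : ∀ σ v s k γ γ' → loc σ v (inChild s k γ) ≡ loc σ v (inChild s k γ') →
    loc (σ xor odd k) (child s v k) γ ≡ loc (σ xor odd k) (child s v k) γ'
  childLoc-injective σ v s k γ γ' e = cong₂ _,_ (negateIf-injective ns _ _
      (∙-cancelˡ (+ childPosition v k) _ _ E)) (cong proj₁ e)
    where
    ns = isRight s
    l = loc (σ xor odd k) (child s v k) γ
    l' = loc (σ xor odd k) (child s v k) γ'
    E : + childPosition v k Z.+ negateIf ns (proj₁ l) ≡ + childPosition v k Z.+ negateIf ns (proj₁ l')
    E = trans (sym (childCoord-normalise v s k (proj₁ l))) (trans (cong (λ q → negateIf ns (proj₂ q)) e)
        (childCoord-normalise v s k (proj₁ l')))

  rayCoord≢0 : ∀ s i → + 0 ≡ rayCoord s i → ⊥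
  rayCoord≢0 s i e = negateIf-suc≢0 (isRight s) i (sym e)

  rayCoord-injective : ∀ v s k j s' k' j' → j < gap v → j' < gap v → rayCoord s (k * period v + j) ≡ rayCoord
      s' (k' * period v + j') → (s ≡ s') × (k ≡ k') × (j ≡ j')
  rayCoord-injective v s k j s' k' j' lj lj' e with negateIf-suc-injective (isRight s) (isRight s') _ _ e
  ... | en , ei with isRight-injective s s' en | division-unique (period v) k j k' j'
      (NP.<-trans lj (gap<period v)) (NP.<-trans lj' (gap<period v)) ei
  ... | refl | refl , refl = refl , refl , refl

  loc-injective : ∀ σ v α β → Valid v α → Valid v β → loc σ v α ≡ loc σ v β → α ≡ β
  loc-injective σ v root root _ _ e = refl
  loc-injective σ v root (gapCell s k j) _ _ e = ⊥-elim (rayCoord≢0 s _ (cong proj₂ e))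
  loc-injective σ v root (armCell s k j t) _ _ e = ⊥-elim (rayCoord≢0 s _ (cong proj₂ e))
  loc-injective σ v root (inChild s k γ) _ (lk , vγ) e = ⊥-elim (childCoord≢0 v s k _
      (childLoc-bound σ v s k γ lk vγ) (sym (cong proj₂ e)))
  loc-injective σ v (gapCell s k j) root _ _ e = ⊥-elim (rayCoord≢0 s _ (sym (cong proj₂ e)))
  loc-injective σ v (armCell s k j t) root _ _ e = ⊥-elim (rayCoord≢0 s _ (sym (cong proj₂ e)))
  loc-injective σ v (inChild s k γ) root (lk , vγ) _ e = ⊥-elim (childCoord≢0 v s k _
      (childLoc-bound σ v s k γ lk vγ) (cong proj₂ e))
  loc-injective σ v (gapCell s k j) (gapCell s' k' j') (_ , lj) (_ , lj') e with rayCoord-injective v s k j s'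
      k' j' lj lj' (cong proj₂ e)
  ... | refl , refl , refl = refl
  loc-injective σ v (gapCell s k j) (armCell s' k' j' t') _ _ e = ⊥-elim
      (negateIf-suc≢0 (armSign σ s' k') t' (sym (cong proj₁ e)))
  loc-injective σ v (armCell s k j t) (gapCell s' k' j') _ _ e = ⊥-elim
      (negateIf-suc≢0 (armSign σ s k) t (cong proj₁ e))
  loc-injective σ v (armCell s k j t) (armCell s' k' j' t') (_ , lj , _) (_ , lj' , _) e with
      rayCoord-injective v s k j s' k' j' lj lj' (cong proj₂ e)
  ... | refl , refl , refl with negateIf-suc-injective (armSign σ s k) (armSign σ s k) t t' (cong proj₁ e)
  ... | _ , refl = refl
  loc-injective σ v (gapCell s k j) (inChild s' k' γ) (lk , lj) (lk' , vγ) e = ⊥-elim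
      (gapCell≢childCell σ v s k j s' k' γ lk lj lk' vγ (+ 0) (inj₁ refl) e)
  loc-injective σ v (inChild s' k' γ) (gapCell s k j) (lk' , vγ) (lk , lj) e = ⊥-elim
      (gapCell≢childCell σ v s k j s' k' γ lk lj lk' vγ (+ 0) (inj₁ refl) (sym e))
  loc-injective σ v (armCell s k j t) (inChild s' k' γ) (lk , lj , lt) (lk' , vγ) e = ⊥-elim
      (gapCell≢childCell σ v s k j s' k' γ lk lj lk' vγ (negateIf (armSign σ s k) (+ suc t))
      (inj₂ (t , lt , refl)) e)
  loc-injective σ v (inChild s' k' γ) (armCell s k j t) (lk' , vγ) (lk , lj , lt) e = ⊥-elim
      (gapCell≢childCell σ v s k j s' k' γ lk lj lk' vγ (negateIf (armSign σ s k) (+ suc t))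
      (inj₂ (t , lt , refl)) (sym e))
  loc-injective σ v (inChild s k γ) (inChild s' k' γ') (lk , vγ) (lk' , vγ') e with sameChild σ v s k γ s' k'
      γ' lk vγ lk' vγ' e
  ... | refl , refl = cong (inChild s k) (loc-injective (σ xor odd k) (child s v k) γ γ' vγ vγ'
      (childLoc-injective σ v s k γ γ' e))

  enc≡place∘loc : ∀ F v α → enc F v α ≡ place F (loc (parity F) v α)
  enc≡place∘loc F v root = refl
  enc≡place∘loc F v (gapCell s k j) = refl
  enc≡place∘loc F v (armCell s k j t) = refl
  enc≡place∘loc (frame originX originY true σ) v (inChild s k α) = trans
      (enc≡place∘loc (childFrame (frame originX originY true σ) v s k) (child s v k) α)
    (cong₂ _,_ (ZP.+-assoc originX (rayCoord s (k * period v + gap v)) _)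
        (cong (Z._+ _) (ZP.+-identityʳ originY)))
  enc≡place∘loc (frame originX originY false σ) v (inChild s k α) = trans
      (enc≡place∘loc (childFrame (frame originX originY false σ) v s k) (child s v k) α)
    (cong₂ _,_ (cong (Z._+ _) (ZP.+-identityʳ originX)) (ZP.+-assoc originY (rayCoord s (k * period v + gap v)) _))

  place-injective : ∀ F p q → place F p ≡ place F q → p ≡ q
  place-injective (frame originX originY true σ) (u , w) (u' , w') e = cong₂ _,_
      (∙-cancelˡ originY u u' (cong proj₂ e)) (∙-cancelˡ originX w w' (cong proj₁ e))
  place-injective (frame originX originY false σ) (u , w) (u' , w') e = cong₂ _,_
      (∙-cancelˡ originX u u' (cong proj₁ e)) (∙-cancelˡ originY w w' (cong proj₂ e))

  enc-injective : ∀ F v α β → Valid v α → Valid v β → enc F v α ≡ enc F v β → α ≡ β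
  enc-injective F v α β va vb e = loc-injective (parity F) v α β va vb
      (place-injective F _ _ (trans (sym (enc≡place∘loc F v α)) (trans e (enc≡place∘loc F v β))))


module LayoutEnumeration (P0 : Game) where

  open Order
  open Layout P0
  open LayoutValues P0
  open import Data.Nat as N using (ℕ; zero; suc; _+_; _≤_; _<_; s≤s; z≤n)
  open import Data.Nat.Properties as NP using (≤-trans; ≤-pred)
  open import Data.Bool using (Bool)
  open import Data.Product using (_×_; _,_; ∃)
  open import Data.Sum using (inj₁; inj₂)
  open import Data.List using (List; []; _∷_; _++_; map; concatMap; upTo)
  open import Data.List.Relation.Unary.Any as Any using (Any)
  open import Data.List.Membership.Propositional using (_∈_; lose; find)
  open import Data.List.Membership.Propositional.Properties
  open import Relation.Binary.PropositionalEquality using (refl)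
  open import Data.Unit using (tt)
  open import Data.Empty using (⊥; ⊥-elim)

  gapAndArmCells : Player → ℕ → ℕ → List Address
  gapAndArmCells s k j = gapCell s k j ∷ map (armCell s k j) (upTo armLength)

  mutual
    addressesUpTo : ℕ → Game → List Address
    addressesUpTo zero v = root ∷ []
    addressesUpTo (suc f) v = root ∷ sideAddresses f Left v ++ sideAddresses f Right v

    sideAddresses : ℕ → Player → Game → List Address
    sideAddresses f s v = concatMap (λ k → concatMap (gapAndArmCells s k) (upTo (gap v)) ++ map (inChild s k)
        (addressesUpTo f (child s v k))) (upTo (nChildren s v))

  birthday-child : ∀ s v k → k < nChildren s v → birthday (child s v k) < birthday v
  birthday-child Left ⟨ L ∣ R ⟩ k l = birthday-leftOption {R = R} (nth-∈ L k l)
  birthday-child Right ⟨ L ∣ R ⟩ k l = birthday-rightOption {L = L} (nth-∈ R k l)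

  ∈-sideAddresses : ∀ f s v {α} → (∃ λ k → k < nChildren s v × α ∈ (concatMap (gapAndArmCells s k)
      (upTo (gap v)) ++ map (inChild s k) (addressesUpTo f (child s v k)))) → α ∈ sideAddresses f s v
  ∈-sideAddresses f s v (k , lk , m) = ∈-concatMap⁺ (λ k → concatMap (gapAndArmCells s k) (upTo (gap v)) ++ map
      (inChild s k) (addressesUpTo f (child s v k))) (lose {P = λ k → _ ∈
      (concatMap (gapAndArmCells s k) (upTo (gap v)) ++ map (inChild s k) (addressesUpTo f (child s v k)))}
      (∈-upTo⁺ lk) m)

  ∈-gapAndArmCells : ∀ s k g {α} → (∃ λ j → j < g × α ∈ gapAndArmCells s k j) → α ∈ concatMap
      (gapAndArmCells s k) (upTo g)
  ∈-gapAndArmCells s k g (j , lj , m) = ∈-concatMap⁺ (gapAndArmCells s k)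
      (lose {P = λ j → _ ∈ gapAndArmCells s k j} (∈-upTo⁺ lj) m)

  ∈-addressesUpTo-side : ∀ f v s {α} → α ∈ sideAddresses f s v → α ∈ addressesUpTo (suc f) v
  ∈-addressesUpTo-side f v Left m = Any.there (∈-++⁺ˡ m)
  ∈-addressesUpTo-side f v Right m = Any.there (∈-++⁺ʳ (sideAddresses f Left v) m)

  addressesUpTo-complete : ∀ f v α → birthday v ≤ f → Valid v α → α ∈ addressesUpTo f v
  addressesUpTo-complete zero ⟨ _ ∣ _ ⟩ α () _
  addressesUpTo-complete (suc f) v root h _ = Any.here refl
  addressesUpTo-complete (suc f) v (gapCell s k j) h (lk , lj) = ∈-addressesUpTo-side f v s
      (∈-sideAddresses f s v (k , lk , ∈-++⁺ˡ (∈-gapAndArmCells s k (gap v) (j , lj , Any.here refl))))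
  addressesUpTo-complete (suc f) v (armCell s k j t) h (lk , lj , lt) = ∈-addressesUpTo-side f v s
      (∈-sideAddresses f s v (k , lk , ∈-++⁺ˡ (∈-gapAndArmCells s k (gap v)
      (j , lj , Any.there (∈-map⁺ (armCell s k j) (∈-upTo⁺ lt))))))
  addressesUpTo-complete (suc f) v (inChild s k α) h (lk , vα) = ∈-addressesUpTo-side f v s
      (∈-sideAddresses f s v (k , lk , ∈-++⁺ʳ (concatMap (gapAndArmCells s k) (upTo (gap v)))
      (∈-map⁺ (inChild s k) (addressesUpTo-complete f (child s v k) α
      (≤-pred (≤-trans (birthday-child s v k lk) h)) vα))))

  mutual
    addressesUpTo-sound : ∀ f v {α} → α ∈ addressesUpTo f v → Valid v α
    addressesUpTo-sound zero v (Any.here refl) = tt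
    addressesUpTo-sound (suc f) v (Any.here refl) = tt
    addressesUpTo-sound (suc f) v (Any.there m) with ∈-++⁻ (sideAddresses f Left v) m
    ... | inj₁ m1 = sideAddresses-sound f Left v m1
    ... | inj₂ m2 = sideAddresses-sound f Right v m2

    sideAddresses-sound : ∀ f s v {α} → α ∈ sideAddresses f s v → Valid v α
    sideAddresses-sound f s v m with find (∈-concatMap⁻ (λ k → concatMap (gapAndArmCells s k) (upTo (gap v)) ++
        map (inChild s k) (addressesUpTo f (child s v k))) {upTo (nChildren s v)} m)
    ... | k , mk , mα with ∈-++⁻ (concatMap (gapAndArmCells s k) (upTo (gap v))) mα
    ... | inj₂ m2 with ∈-map⁻ (inChild s k) m2
    ... | β , mβ , refl = ∈-upTo⁻ mk , addressesUpTo-sound f (child s v k) mβ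
    sideAddresses-sound f s v m | k , mk , mα | inj₁ m1 with find (∈-concatMap⁻ (gapAndArmCells s k)
        {upTo (gap v)} m1)
    ... | j , mj , Any.here refl = ∈-upTo⁻ mk , ∈-upTo⁻ mj
    ... | j , mj , Any.there ma with ∈-map⁻ (armCell s k j) ma
    ... | t , mt , refl = ∈-upTo⁻ mk , ∈-upTo⁻ mj , ∈-upTo⁻ mt


module Realisation (G : Game) where

  open Order
  open Canonical
  P0 : Game
  P0 = reduce G

  open Layout P0
  open LayoutValues P0
  open LayoutRays P0
  open LayoutInjective P0 using (enc-injective)
  open LayoutEnumeration P0
  open import Data.Nat.Properties using (≤-refl)
  open import Data.Integer as ℤ using (+_)
  open import Data.Bool using (true; false)
  open import Data.Unit using (tt)
  open import Data.Empty using (⊥-elim)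
  open import Data.List.Relation.Unary.Any using (here; there)
  open import Data.List.Relation.Unary.All using ([]; _∷_)
  open import Data.List.Relation.Unary.AllPairs using ([]; _∷_)
  open import Data.List.Membership.Propositional.Properties using (∈-map⁺)
  open import Data.Product.Properties using (≡-dec)
  open import Relation.Nullary using (Dec; yes; no)

  rootFrame : Frame
  rootFrame = frame (+ 0) (+ 0) true false

  cell : Address → Cell
  cell = enc rootFrame P0

  ray₀ : Address → Dir → Player × List Address
  ray₀ = ray true false P0

  addresses : List Address
  addresses = addressesUpTo (birthday P0) P0

  boardRooms : List Cell
  boardRooms = map cell addresses

  rayColour : Player × List Address → Colour
  rayColour (p , []) = black
  rayColour (p , _ ∷ _) = colourOf p

  _≟ᶜ_ : (c c′ : Cell) → Dec (c ≡ c′)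
  _≟ᶜ_ = ≡-dec ℤ._≟_ ℤ._≟_

  paintFrom : List Address → Cell → Dir → Colour
  paintFrom [] c d = black
  paintFrom (a ∷ as) c d with cell a ≟ᶜ c
  ... | yes _ = rayColour (ray₀ a d)
  ... | no _ = paintFrom as c d

  paint : Cell → Dir → Colour
  paint = paintFrom addresses

  ∈-addresses : ∀ {a} → Valid P0 a → a ∈ addresses
  ∈-addresses = addressesUpTo-complete (birthday P0) P0 _ ≤-refl

  paintFrom-cell : ∀ as {α} d → α ∈ as → (∀ {b} → b ∈ as → Valid P0 b) → Valid P0 α →
    paintFrom as (cell α) d ≡ rayColour (ray₀ α d)
  paintFrom-cell (a ∷ as) {α} d α∈ valid vα with cell a ≟ᶜ cell α
  ... | yes e = cong (λ b → rayColour (ray₀ b d)) (enc-injective rootFrame P0 _ _ (valid (here refl)) vα e)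
  paintFrom-cell (a ∷ as) d (here refl) valid vα | no ne = ⊥-elim (ne refl)
  paintFrom-cell (a ∷ as) d (there α∈) valid vα | no _ = paintFrom-cell as d α∈ (λ b∈ → valid (there b∈)) vα

  paint-cell : ∀ {α d r} → Valid P0 α → ray₀ α d ≡ r → paint (cell α) d ≡ rayColour r
  paint-cell {d = d} vα e = trans (paintFrom-cell addresses d (∈-addresses vα)
      (addressesUpTo-sound (birthday P0) P0) vα) (cong rayColour e)

  options-ray₀ : ∀ p {a} → Valid P0 a → ∀ {g} → g ∈ options p (value P0 a) →
    ∃ λ d → ∃ λ ts → ∃ λ t → (ray₀ a d ≡ (p , ts)) × (t ∈ ts) × (g ≡ value P0 t)
  options-ray₀ p = options-rayOption p true false P0 _

  ray-options₀ : ∀ p {a d ts t} → Valid P0 a → ray₀ a d ≡ (p , ts) → t ∈ ts → value P0 t ∈ options p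
      (value P0 a)
  ray-options₀ p va e t∈ = ray-options p true false P0 _ _ _ va (cong proj₁ e)
      (subst (λ r → _ ∈ proj₂ r) (sym e) t∈)

  cell-injective : ∀ {a b} → Valid P0 a → Valid P0 b → cell a ≡ cell b → a ≡ b
  cell-injective va vb = enc-injective rootFrame P0 _ _ va vb

  cell-room : ∀ {a} → Valid P0 a → cell a ∈ boardRooms
  cell-room va = ∈-map⁺ cell (∈-addresses va)

  ray-step₀ : ∀ {a d p t ts} → Valid P0 a → ray₀ a d ≡ (p , t ∷ ts) →
    Valid P0 t × (cell t ≡ shift (cell a) d 1) × (ray₀ t d ≡ (p , ts))
  ray-step₀ va e = ray-step rootFrame P0 _ _ _ _ _ va e

  open RayBoard Address cell ray₀ (value P0) (Valid P0) boardRooms paint cell-injective cell-room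
    paint-cell paint-cell ray-step₀ options-ray₀ ray-options₀

  position : Position
  position = mkPosition boardRooms paint (cell root ∷ []) (cell-room tt ∷ []) ([] ∷ [])

  realised : Game
  realised = value P0 root

  position-value : HasValue position realised
  position-value = pieceAt-value _ root [] ≤-refl tt (λ ())

  realised-≈G : realised ≈G G
  realised-≈G = ≈G-trans (node-≈G P0 (reduce-reduced G , ≤-refl)) (reduce-≈G G)


mainTheorem4 : ∀ (G : Game) →
    ∃ λ (P : Position) → ∃ λ (H : Game) → HasValue P H × (H ≈G G)
mainTheorem4 G = position , realised , position-value , realised-≈G
  where open Realisation G
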